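{- Let $q>2$ be a prime power, $n\ge1$ with $\gcd(n,q)=1$, $A_n=GF(q)[x]/(x^n-1)$, and let $J\subseteq A_n$ be the ideal with parity-check polynomial $h(x)=\prod_{i=1}^t h_i(x)$, the $h_i$ distinct monic irreducible polynomials over $GF(q)$. Let $c(x)=\prod_{j=1}^k h_{i_j}(x)$ with $k>1$, where each $h_{i_j}$ has degree $m_{i_j}$ and order $n_{i_j}\ne q^{m_{i_j}}-1$, and let $n_c=\mathrm{lcm}(n_{i_1},\dots,n_{i_k})$ be the order of $c$. Let $C$ be the set of elements of $J$ with minimal polynomial $c(x)$, $s_c$ the number of cycles contained in $C$, $R_c$ the number of proportionality classes contained in $C$, $d_c=\gcd(q-1,n_c)$, $r_c=n_c/d_c$ and $b_c=(q-1)/d_c$. If at least one of the conditions (1) $s_c=b_c$ with $1<b_c\le q-1$; (2) $r_c=R_c$; (3) $\gcd(s_c,R_c)=1$ holds, then all elements of $C$ have the same Hamming weight.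
   Context: $J$ is the ideal generated by $(x^n-1)/h(x)$. For $z\in A_n$, its minimal polynomial is the monic polynomial $c$ of least degree with $c(x)z(x)\equiv0\pmod{x^n-1}$. The order of a polynomial $f$ with $f(0)\ne0$ is the least $e\ge1$ with $f\mid x^e-1$. For nonzero $z\in A_n$: the cycle of $z$ is $\{x^jz:j\ge0\}$ in $A_n$; the proportionality class of $z$ is $\{\alpha z:\alpha\in GF(q)^*\}$. The Hamming weight is the number of nonzero coefficients of the representative of degree $<n$. This is the second of two results the paper labels "Corollary 7". -}

module Defs where

open import Level using (0ℓ)
open import Data.Nat as ℕ using (ℕ; zero; suc; _≤_; _<_; _∸_)
open import Data.Nat.DivMod using (_/_)
open import Data.Nat.LCM using (lcm)
open import Data.Nat.Primality using (Prime)
open import Data.Fin as Fin using (Fin)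
open import Data.Fin.Properties using () renaming (_≟_ to _≟ᶠ_)
open import Data.List as List using (List; []; _∷_; _++_; [_])
open import Data.Vec as Vec using (Vec; []; _∷_)
open import Data.Product using (Σ; ∃; ∃-syntax; _×_; _,_)
open import Data.Sum using (_⊎_)
open import Function using (_∘_; _↔_; Inverse)
open import Relation.Nullary using (¬_; Dec; yes; no)
open import Relation.Nullary.Decidable using (¬?; map′)
open import Relation.Binary.PropositionalEquality using (_≡_; _≢_; refl; cong; sym; trans)
open import Algebra.Structures using (IsCommutativeRing)

record Field : Set₁ where
  infixl 7 _*_
  infixl 6 _+_
  field
    Carrier : Set
    _+_ _*_ : Carrier → Carrier → Carrier
    -_      : Carrier → Carrier
    0# 1#   : Carrier
    isCommutativeRing : IsCommutativeRing _≡_ _+_ _*_ -_ 0# 1#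
    0≢1     : 0# ≢ 1#
    inverse : ∀ x → x ≢ 0# → ∃[ y ] (x * y ≡ 1#)

HasSize : Field → ℕ → Set
HasSize F q = Fin q ↔ Field.Carrier F

module FieldDefs (F : Field) where
  open Field F

  -- Polynomials over F: coefficient lists, lowest degree first.
  Poly : Set
  Poly = List Carrier

  coeff : Poly → ℕ → Carrier
  coeff []      _       = 0#
  coeff (a ∷ p) zero    = a
  coeff (a ∷ p) (suc i) = coeff p i

  -- equality of polynomials (ignores trailing zero coefficients)
  infix 4 _≈P_
  _≈P_ : Poly → Poly → Set
  p ≈P r = ∀ i → coeff p i ≡ coeff r i

  infixl 6 _+P_
  _+P_ : Poly → Poly → Poly
  []      +P r       = r
  (a ∷ p) +P []      = a ∷ p
  (a ∷ p) +P (b ∷ r) = (a + b) ∷ (p +P r)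

  scaleP : Carrier → Poly → Poly
  scaleP a = List.map (a *_)

  infixl 7 _*P_
  _*P_ : Poly → Poly → Poly
  []      *P r = []
  (a ∷ p) *P r = scaleP a r +P (0# ∷ (p *P r))

  oneP : Poly
  oneP = [ 1# ]

  monomial : ℕ → Poly
  monomial e = List.replicate e 0# ++ [ 1# ]

  xPowMinus1 : ℕ → Poly
  xPowMinus1 e = monomial e +P [ - 1# ]

  productP : List Poly → Poly
  productP = List.foldr _*P_ oneP

  infix 4 _∣P_
  _∣P_ : Poly → Poly → Set
  f ∣P g = ∃[ u ] (u *P f ≈P g)

  Monic : Poly → Set
  Monic p = ∃[ r ] (p ≡ r ++ [ 1# ])

  -- degree (meaningful for monic / normalised lists)
  deg : Poly → ℕ
  deg p = List.length p ∸ 1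

  IsConstant : Poly → Set
  IsConstant a = ∀ i → coeff a (suc i) ≡ 0#

  MonicIrreducible : Poly → Set
  MonicIrreducible f =
    Monic f × 1 ≤ deg f × (∀ a b → a *P b ≈P f → IsConstant a ⊎ IsConstant b)

  IsOrder : Poly → ℕ → Set
  IsOrder f e = 1 ≤ e × f ∣P xPowMinus1 e ×
                (∀ e′ → 1 ≤ e′ → f ∣P xPowMinus1 e′ → e ≤ e′)

  -- A_n = F[x]/(x^n - 1); an element is its representative of degree < n,
  -- stored as the vector of coefficients (index i = coefficient of x^i).
  A : ℕ → Set
  A n = Vec Carrier n

  zeroA : ∀ {n} → A n
  zeroA = Vec.replicate _ 0#

  oneA : ∀ {n} → A n
  oneA {zero}  = []
  oneA {suc n} = 1# ∷ Vec.replicate n 0#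

  _+A_ : ∀ {n} → A n → A n → A n
  _+A_ = Vec.zipWith _+_

  _·A_ : ∀ {n} → Carrier → A n → A n
  α ·A z = Vec.map (α *_) z

  mulX : ∀ {n} → A n → A n
  mulX {zero}  z = z
  mulX {suc n} z = Vec.last z ∷ Vec.init z

  mulXPow : ∀ {n} → ℕ → A n → A n
  mulXPow zero    z = z
  mulXPow (suc j) z = mulX (mulXPow j z)

  -- p(x) z(x) mod (x^n - 1)   (Horner)
  act : ∀ {n} → Poly → A n → A n
  act []      z = zeroA
  act (a ∷ p) z = (a ·A z) +A mulX (act p z)

  toA : ∀ {n} → Poly → A n
  toA p = act p oneA

  InIdeal : ∀ {n} → Poly → A n → Set
  InIdeal g z = ∃[ a ] (z ≡ act a (toA g))

  IsMinPoly : ∀ {n} → Poly → A n → Set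
  IsMinPoly c z = Monic c × act c z ≡ zeroA ×
                  (∀ c′ → Monic c′ → act c′ z ≡ zeroA → deg c ≤ deg c′)

  NonZeroA : ∀ {n} → A n → Set
  NonZeroA z = z ≢ zeroA

  InCycle : ∀ {n} → A n → A n → Set
  InCycle z u = ∃[ j ] (u ≡ mulXPow j z)

  InPropClass : ∀ {n} → A n → A n → Set
  InPropClass z u = ∃[ α ] (α ≢ 0# × u ≡ α ·A z)

  module _ {q : ℕ} (enum : HasSize F q) where
    open Inverse enum

    _≟F_ : (a b : Carrier) → Dec (a ≡ b)
    a ≟F b = map′ (λ e → trans (sym (strictlyInverseˡ a)) (trans (cong to e) (strictlyInverseˡ b)))
                  (cong from) (from a ≟ᶠ from b)

    weight : ∀ {n} → A n → ℕ
    weight = Vec.count (λ a → ¬? (a ≟F 0#))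

-- Cls z u : "u belongs to the class of z" (classes only for nonzero z).
-- ClassCount Cls NZ P s : exactly s distinct classes of nonzero elements
-- are contained in P.

SameClass : {X : Set} → (X → X → Set) → X → X → Set
SameClass Cls z w = ∀ u → (Cls z u → Cls w u) × (Cls w u → Cls z u)

ClassCount : {X : Set} → (X → X → Set) → (X → Set) → (X → Set) → ℕ → Set
ClassCount {X} Cls NZ P s =
  Σ (Vec X s) λ reps →
    (∀ j → NZ (Vec.lookup reps j)) ×
    (∀ j u → Cls (Vec.lookup reps j) u → P u) ×
    (∀ j j′ → SameClass Cls (Vec.lookup reps j) (Vec.lookup reps j′) → j ≡ j′) ×
    (∀ z → NZ z → (∀ u → Cls z u → P u) →
       ∃[ j ] SameClass Cls z (Vec.lookup reps j))

lcmList : List ℕ → ℕ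
lcmList = List.foldr lcm 1

-- division, used only with nonzero divisors (d_c ≥ 1 since q - 1 ≥ 2)
_/?_ : ℕ → ℕ → ℕ
m /? zero    = 0
m /? suc d   = m / suc d

IsPrimePower : ℕ → Set
IsPrimePower q = ∃[ p ] ∃[ e ] (Prime p × 1 ≤ e × q ≡ p ℕ.^ e)

-- The nonzero scalars and multiplication by x generate a group acting on C, the elements of J with
-- minimal polynomial c, and the action preserves Hamming weight. Since distinct monic irreducibles are
-- coprime, c divides x^e - 1 exactly when n_c divides e, so every element of C has period n_c under x;
-- nonzero scalars act freely. Hence a subset of C stable under both actions that consists of a cycles
-- and b proportionality classes satisfies a n_c = b (q - 1), and s n_c = R (q - 1) for C itself. If C
-- were not a single orbit, one orbit would give 0 < a < s and 0 < b < R, which each of the three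
-- conditions excludes by elementary arithmetic.

module Submission where

open import Level using (0ℓ)
open import Algebra using (CommutativeRing; CommutativeSemiring)
open import Algebra.Structures using (IsCommutativeRing)
import Algebra.Properties.Ring as RingProperties
import Algebra.Solver.Ring.NaturalCoefficients.Default as SemiringSolver
open import Data.Bool using (true; false; if_then_else_)
open import Data.Nat as ℕ using (ℕ; zero; suc; _<_; _≤_; s≤s; z≤n; NonZero; _∸_; _^_)
import Data.Nat.Properties as ℕ
import Data.Nat.Divisibility as ℕ
open import Data.Nat.DivMod using (_/_; _%_; m≡m%n+[m/n]*n; m%n<n; m/n*n≡m)
open import Data.Nat.GCD using (gcd; gcd[m,n]∣m; gcd[m,n]≢0; gcd-comm)
open import Data.Nat.LCM using (lcm; lcm-least; lcm-comm; gcd*lcm; m∣lcm[m,n]; n∣lcm[m,n])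
open import Data.Nat.Coprimality using (gcd≡1⇒coprime; coprime-divisor)
open import Data.Nat.Induction using (<-rec)
open import Data.Nat.Tactic.RingSolver using (solve-∀)
open import Data.Fin as Fin using (Fin; toℕ; fromℕ<; punchIn; punchOut)
import Data.Fin.Properties as Fin
open import Data.List as List using ([]; _∷_; _++_; [_]; tabulate)
import Data.List.Properties as List
open import Data.Vec as Vec using (Vec; []; _∷_)
import Data.Vec.Properties as Vec
open import Data.Product using (Σ; ∃-syntax; ∃₂; _×_; _,_; proj₁; proj₂)
open import Data.Sum using (_⊎_; inj₁; inj₂; [_,_]′)
open import Data.Empty using (⊥-elim)
open import Function using (_∘_; id; Inverse; mk⇔)
open import Function.Definitions using (Injective)
open import Relation.Nullary using (¬_; yes; no; does)
open import Relation.Nullary.Decidable using (¬?; does-⇔)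
open import Relation.Unary using (Decidable)
open import Relation.Binary.Bundles using (Setoid)
open import Relation.Binary.Definitions using (DecidableEquality; Tri; tri<; tri≈; tri>)
open import Relation.Binary.PropositionalEquality
  using (_≡_; _≢_; refl; cong; cong₂; sym; trans; subst; subst₂; module ≡-Reasoning)
import Relation.Binary.Reasoning.Setoid as SetoidReasoning

open import Defs

module FieldProperties (F : Field) where
  open Field F public
  open IsCommutativeRing isCommutativeRing public
    hiding (refl; sym; trans; reflexive; isEquivalence; setoid; zero)

  commutativeRing : CommutativeRing 0ℓ 0ℓ
  commutativeRing = record { isCommutativeRing = isCommutativeRing }

  open RingProperties (CommutativeRing.ring commutativeRing) public using (-1*x≈-x)

  1≢0 : 1# ≢ 0#
  1≢0 e = 0≢1 (sym e)

  inverseˡ : ∀ x → x ≢ 0# → ∃[ y ] (y * x ≡ 1#)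
  inverseˡ x x≢0 with inverse x x≢0
  ... | y , xy≡1 = y , trans (*-comm y x) xy≡1

  inverse-nonzero : ∀ {x y} → y * x ≡ 1# → y ≢ 0#
  inverse-nonzero {x} yx≡1 y≡0 = 0≢1 (trans (sym (zeroˡ x)) (trans (cong (_* x) (sym y≡0)) yx≡1))

  *-nonzero : ∀ {x y} → x ≢ 0# → y ≢ 0# → x * y ≢ 0#
  *-nonzero {x} {y} x≢0 y≢0 xy≡0 with inverseˡ x x≢0
  ... | x⁻¹ , x⁻¹x≡1 = y≢0 (begin
    y              ≡⟨ sym (*-identityˡ y) ⟩
    1# * y         ≡⟨ cong (_* y) (sym x⁻¹x≡1) ⟩
    (x⁻¹ * x) * y  ≡⟨ *-assoc x⁻¹ x y ⟩
    x⁻¹ * (x * y)  ≡⟨ cong (x⁻¹ *_) xy≡0 ⟩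
    x⁻¹ * 0#       ≡⟨ zeroʳ x⁻¹ ⟩
    0#             ∎)
    where open ≡-Reasoning

module PolynomialSemiring (F : Field) where
  open FieldProperties F
  open FieldDefs F

  coeff-+P : ∀ p r i → coeff (p +P r) i ≡ coeff p i + coeff r i
  coeff-+P []      r       i       = sym (+-identityˡ _)
  coeff-+P (a ∷ p) []      i       = sym (+-identityʳ _)
  coeff-+P (a ∷ p) (b ∷ r) zero    = refl
  coeff-+P (a ∷ p) (b ∷ r) (suc i) = coeff-+P p r i

  coeff-scaleP : ∀ a p i → coeff (scaleP a p) i ≡ a * coeff p i
  coeff-scaleP a []      i       = sym (zeroʳ a)
  coeff-scaleP a (b ∷ p) zero    = refl
  coeff-scaleP a (b ∷ p) (suc i) = coeff-scaleP a p i

  -- _≈P_ wrapped in a record, so that both polynomials can be inferred from a proof.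
  infix 4 _≋_
  record _≋_ (p r : Poly) : Set where
    constructor coeffwise
    field coeff-≡ : p ≈P r
  open _≋_ public

  ≋-refl : ∀ {p} → p ≋ p
  ≋-refl = coeffwise λ _ → refl

  ≋-sym : ∀ {p r} → p ≋ r → r ≋ p
  ≋-sym (coeffwise e) = coeffwise λ i → sym (e i)

  ≋-trans : ∀ {p r u} → p ≋ r → r ≋ u → p ≋ u
  ≋-trans (coeffwise e) (coeffwise f) = coeffwise λ i → trans (e i) (f i)

  ≋-reflexive : ∀ {p r} → p ≡ r → p ≋ r
  ≋-reflexive refl = ≋-refl

  ≋-setoid : Setoid 0ℓ 0ℓ
  ≋-setoid = record
    { Carrier = Poly ; _≈_ = _≋_
    ; isEquivalence = record { refl = ≋-refl ; sym = ≋-sym ; trans = ≋-trans } }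

  ∷-cong : ∀ {a a′ p p′} → a ≡ a′ → p ≋ p′ → a ∷ p ≋ a′ ∷ p′
  ∷-cong a≡a′ (coeffwise e) = coeffwise λ { zero → a≡a′ ; (suc i) → e i }

  []≋[0] : [] ≋ [ 0# ]
  []≋[0] = coeffwise λ { zero → refl ; (suc i) → refl }

  +P-cong : ∀ {p p′ r r′} → p ≋ p′ → r ≋ r′ → p +P r ≋ p′ +P r′
  +P-cong {p} {p′} {r} {r′} (coeffwise e) (coeffwise f) = coeffwise λ i →
    trans (coeff-+P p r i) (trans (cong₂ _+_ (e i) (f i)) (sym (coeff-+P p′ r′ i)))

  scaleP-cong : ∀ {a a′ p p′} → a ≡ a′ → p ≋ p′ → scaleP a p ≋ scaleP a′ p′
  scaleP-cong {a} {a′} {p} {p′} a≡a′ (coeffwise e) = coeffwise λ i →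
    trans (coeff-scaleP a p i) (trans (cong₂ _*_ a≡a′ (e i)) (sym (coeff-scaleP a′ p′ i)))

  +P-comm : ∀ p r → p +P r ≋ r +P p
  +P-comm p r = coeffwise λ i →
    trans (coeff-+P p r i) (trans (+-comm _ _) (sym (coeff-+P r p i)))

  +P-assoc : ∀ p r u → (p +P r) +P u ≋ p +P (r +P u)
  +P-assoc p r u = coeffwise λ i → begin
    coeff ((p +P r) +P u) i                ≡⟨ coeff-+P (p +P r) u i ⟩
    coeff (p +P r) i + coeff u i           ≡⟨ cong (_+ coeff u i) (coeff-+P p r i) ⟩
    coeff p i + coeff r i + coeff u i      ≡⟨ +-assoc _ _ _ ⟩
    coeff p i + (coeff r i + coeff u i)    ≡⟨ cong (coeff p i +_) (sym (coeff-+P r u i)) ⟩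
    coeff p i + coeff (r +P u) i           ≡⟨ sym (coeff-+P p (r +P u) i) ⟩
    coeff (p +P (r +P u)) i                ∎
    where open ≡-Reasoning

  +P-identityʳ : ∀ p → p +P [] ≋ p
  +P-identityʳ p = coeffwise λ i → trans (coeff-+P p [] i) (+-identityʳ _)

  +P-interchange : ∀ p r u v → (p +P r) +P (u +P v) ≋ (p +P u) +P (r +P v)
  +P-interchange p r u v = ≋-trans (+P-assoc p r (u +P v)) (≋-trans
    (+P-cong (≋-refl {p}) (≋-trans (≋-sym (+P-assoc r u v)) (≋-trans
      (+P-cong (+P-comm r u) ≋-refl) (+P-assoc u r v))))
    (≋-sym (+P-assoc p u (r +P v))))

  0∷-+P : ∀ p r → 0# ∷ (p +P r) ≋ (0# ∷ p) +P (0# ∷ r)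
  0∷-+P p r = ∷-cong (sym (+-identityʳ 0#)) ≋-refl

  scaleP-zero : ∀ p → scaleP 0# p ≋ []
  scaleP-zero p = coeffwise λ i → trans (coeff-scaleP 0# p i) (zeroˡ _)

  scaleP-identity : ∀ p → scaleP 1# p ≋ p
  scaleP-identity p = coeffwise λ i → trans (coeff-scaleP 1# p i) (*-identityˡ _)

  scaleP-distribʳ : ∀ a b p → scaleP (a + b) p ≋ scaleP a p +P scaleP b p
  scaleP-distribʳ a b p = coeffwise λ i →
    trans (coeff-scaleP (a + b) p i) (trans (distribʳ _ _ _) (sym (trans
      (coeff-+P (scaleP a p) (scaleP b p) i) (cong₂ _+_ (coeff-scaleP a p i) (coeff-scaleP b p i)))))

  scaleP-distribˡ : ∀ a p r → scaleP a (p +P r) ≋ scaleP a p +P scaleP a r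
  scaleP-distribˡ a p r = coeffwise λ i →
    trans (coeff-scaleP a (p +P r) i) (trans (cong (a *_) (coeff-+P p r i)) (trans (distribˡ _ _ _)
      (sym (trans (coeff-+P (scaleP a p) (scaleP a r) i)
        (cong₂ _+_ (coeff-scaleP a p i) (coeff-scaleP a r i))))))

  scaleP-scaleP : ∀ a b p → scaleP a (scaleP b p) ≋ scaleP (a * b) p
  scaleP-scaleP a b p = coeffwise λ i →
    trans (coeff-scaleP a (scaleP b p) i) (trans (cong (a *_) (coeff-scaleP b p i))
      (trans (sym (*-assoc _ _ _)) (sym (coeff-scaleP (a * b) p i))))

  scaleP-0∷ : ∀ a p → scaleP a (0# ∷ p) ≋ 0# ∷ scaleP a p
  scaleP-0∷ a p = ∷-cong (zeroʳ a) ≋-refl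

  *P-zeroˡ : ∀ {p} r → p ≋ [] → p *P r ≋ []
  *P-zeroˡ {[]}    r p≋[] = ≋-refl
  *P-zeroˡ {a ∷ p} r (coeffwise e) = ≋-trans
    (+P-cong (scaleP-cong (e zero) ≋-refl) (∷-cong refl (*P-zeroˡ {p} r (coeffwise (e ∘ suc)))))
    (+P-cong (scaleP-zero r) (≋-sym []≋[0]))

  *P-zeroʳ : ∀ p → p *P [] ≋ []
  *P-zeroʳ []      = ≋-refl
  *P-zeroʳ (a ∷ p) = ≋-trans (∷-cong refl (*P-zeroʳ p)) (≋-sym []≋[0])

  *P-congˡ : ∀ {p p′} r → p ≋ p′ → p *P r ≋ p′ *P r
  *P-congˡ {[]}    {p′}      r e = ≋-sym (*P-zeroˡ r (≋-sym e))
  *P-congˡ {a ∷ p} {[]}      r e = *P-zeroˡ r e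
  *P-congˡ {a ∷ p} {a′ ∷ p′} r (coeffwise e) =
    +P-cong (scaleP-cong (e zero) ≋-refl) (∷-cong refl (*P-congˡ {p} {p′} r (coeffwise (e ∘ suc))))

  *P-congʳ : ∀ p {r r′} → r ≋ r′ → p *P r ≋ p *P r′
  *P-congʳ []      e = ≋-refl
  *P-congʳ (a ∷ p) e = +P-cong (scaleP-cong refl e) (∷-cong refl (*P-congʳ p e))

  *P-cong : ∀ {p p′ r r′} → p ≋ p′ → r ≋ r′ → p *P r ≋ p′ *P r′
  *P-cong {p′ = p′} {r = r} e f = ≋-trans (*P-congˡ r e) (*P-congʳ p′ f)

  0∷-*P : ∀ p u → (0# ∷ p) *P u ≋ 0# ∷ (p *P u)
  0∷-*P p u = +P-cong (scaleP-zero u) ≋-refl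

  *P-distribʳ : ∀ u p r → (p +P r) *P u ≋ p *P u +P r *P u
  *P-distribʳ u []      r       = ≋-refl
  *P-distribʳ u (a ∷ p) []      = ≋-sym (+P-identityʳ _)
  *P-distribʳ u (a ∷ p) (b ∷ r) = ≋-trans
    (+P-cong (scaleP-distribʳ a b u) (≋-trans (∷-cong refl (*P-distribʳ u p r)) (0∷-+P (p *P u) (r *P u))))
    (+P-interchange (scaleP a u) (scaleP b u) (0# ∷ (p *P u)) (0# ∷ (r *P u)))

  *P-distribˡ : ∀ u p r → u *P (p +P r) ≋ u *P p +P u *P r
  *P-distribˡ []      p r = ≋-refl
  *P-distribˡ (a ∷ u) p r = ≋-trans
    (+P-cong (scaleP-distribˡ a p r) (≋-trans (∷-cong refl (*P-distribˡ u p r)) (0∷-+P (u *P p) (u *P r))))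
    (+P-interchange (scaleP a p) (scaleP a r) (0# ∷ (u *P p)) (0# ∷ (u *P r)))

  scaleP-*Pˡ : ∀ a p r → scaleP a (p *P r) ≋ scaleP a p *P r
  scaleP-*Pˡ a []      r = ≋-refl
  scaleP-*Pˡ a (b ∷ p) r = ≋-trans (scaleP-distribˡ a (scaleP b r) (0# ∷ (p *P r)))
    (+P-cong (scaleP-scaleP a b r) (≋-trans (scaleP-0∷ a (p *P r)) (∷-cong refl (scaleP-*Pˡ a p r))))

  scaleP-*Pʳ : ∀ a p r → p *P scaleP a r ≋ scaleP a (p *P r)
  scaleP-*Pʳ a []      r = ≋-refl
  scaleP-*Pʳ a (b ∷ p) r = ≋-trans
    (+P-cong (≋-trans (scaleP-scaleP b a r) (≋-trans (scaleP-cong (*-comm b a) ≋-refl) (≋-sym (scaleP-scaleP a b r))))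
             (≋-trans (∷-cong refl (scaleP-*Pʳ a p r)) (≋-sym (scaleP-0∷ a (p *P r)))))
    (≋-sym (scaleP-distribˡ a (scaleP b r) (0# ∷ (p *P r))))

  *P-∷ʳ : ∀ p b r → p *P (b ∷ r) ≋ scaleP b p +P (0# ∷ (p *P r))
  *P-∷ʳ []      b r = []≋[0]
  *P-∷ʳ (a ∷ p) b r = ∷-cong (cong (_+ 0#) (*-comm a b)) (≋-trans
    (+P-cong (≋-refl {scaleP a r}) (*P-∷ʳ p b r)) (≋-trans
    (≋-sym (+P-assoc (scaleP a r) (scaleP b p) _)) (≋-trans
    (+P-cong (+P-comm (scaleP a r) (scaleP b p)) ≋-refl)
    (+P-assoc (scaleP b p) _ _))))

  *P-comm : ∀ p r → p *P r ≋ r *P p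
  *P-comm []      r = ≋-sym (*P-zeroʳ r)
  *P-comm (a ∷ p) r = ≋-trans (+P-cong ≋-refl (∷-cong refl (*P-comm p r))) (≋-sym (*P-∷ʳ r a p))

  *P-assoc : ∀ p r u → (p *P r) *P u ≋ p *P (r *P u)
  *P-assoc []      r u = ≋-refl
  *P-assoc (a ∷ p) r u = ≋-trans (*P-distribʳ u (scaleP a r) (0# ∷ (p *P r)))
    (+P-cong (≋-sym (scaleP-*Pˡ a r u)) (≋-trans (0∷-*P (p *P r) u) (∷-cong refl (*P-assoc p r u))))

  [_]*P : ∀ a p → [ a ] *P p ≋ scaleP a p
  [ a ]*P p = ≋-trans (+P-cong ≋-refl (≋-sym []≋[0])) (+P-identityʳ _)

  *P-identityˡ : ∀ p → oneP *P p ≋ p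
  *P-identityˡ p = ≋-trans ([ 1# ]*P p) (scaleP-identity p)

  *P-identityʳ : ∀ p → p *P oneP ≋ p
  *P-identityʳ p = ≋-trans (*P-comm p oneP) (*P-identityˡ p)

  polynomialSemiring : CommutativeSemiring 0ℓ 0ℓ
  polynomialSemiring = record
    { Carrier = Poly ; _≈_ = _≋_ ; _+_ = _+P_ ; _*_ = _*P_ ; 0# = [] ; 1# = oneP
    ; isCommutativeSemiring = record
      { isSemiring = record
        { isSemiringWithoutAnnihilatingZero = record
          { +-isCommutativeMonoid = record
            { isMonoid = record
              { isSemigroup = record
                { isMagma = record { isEquivalence = Setoid.isEquivalence ≋-setoid ; ∙-cong = +P-cong }
                ; assoc = +P-assoc }
              ; identity = (λ p → ≋-refl) , +P-identityʳ }
            ; comm = +P-comm }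
          ; *-cong = *P-cong
          ; *-assoc = *P-assoc
          ; *-identity = *P-identityˡ , *P-identityʳ
          ; distrib = *P-distribˡ , *P-distribʳ }
        ; zero = (λ p → ≋-refl) , *P-zeroʳ }
      ; *-comm = *P-comm } }

  module PolynomialSolver = SemiringSolver polynomialSemiring

module PolynomialDivisibility (F : Field) where
  open FieldProperties F
  open FieldDefs F
  open PolynomialSemiring F
  open PolynomialSolver using (solve; _:=_; _:+_; _:*_; con)

  infix 4 _∣_
  _∣_ : Poly → Poly → Set
  f ∣ g = ∃[ u ] (u *P f ≋ g)

  ∣P⇒∣ : ∀ {f g} → f ∣P g → f ∣ g
  ∣P⇒∣ (u , e) = u , coeffwise e

  ∣⇒∣P : ∀ {f g} → f ∣ g → f ∣P g
  ∣⇒∣P (u , coeffwise e) = u , e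

  ∣-refl : ∀ f → f ∣ f
  ∣-refl f = oneP , *P-identityˡ f

  ∣-respʳ : ∀ {f g g′} → g ≋ g′ → f ∣ g → f ∣ g′
  ∣-respʳ g≋g′ (u , uf≋g) = u , ≋-trans uf≋g g≋g′

  ∣-trans : ∀ {f g h} → f ∣ g → g ∣ h → f ∣ h
  ∣-trans {f} (u , uf≋g) (v , vg≋h) = v *P u , ≋-trans (*P-assoc v u f) (≋-trans (*P-congʳ v uf≋g) vg≋h)

  ∣-*ˡ : ∀ {f g} r → f ∣ g → f ∣ r *P g
  ∣-*ˡ {f} r (u , uf≋g) = r *P u , ≋-trans (*P-assoc r u f) (*P-congʳ r uf≋g)

  ∣-*ʳ-self : ∀ f r → f ∣ f *P r
  ∣-*ʳ-self f r = r , *P-comm r f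

  ∣-+P : ∀ {f g h} → f ∣ g → f ∣ h → f ∣ g +P h
  ∣-+P {f} (u , uf≋g) (v , vf≋h) = u +P v , ≋-trans (*P-distribʳ f u v) (+P-cong uf≋g vf≋h)

  ∣-[] : ∀ f → f ∣ []
  ∣-[] f = [] , ≋-refl

  -1P : Poly
  -1P = [ - 1# ]

  -1P-inverse : ∀ p → p +P -1P *P p ≋ []
  -1P-inverse p = coeffwise λ i → begin
    coeff (p +P -1P *P p) i                 ≡⟨ coeff-+P p (-1P *P p) i ⟩
    coeff p i + coeff (-1P *P p) i          ≡⟨ cong (coeff p i +_) (coeff-≡ ([ - 1# ]*P p) i) ⟩
    coeff p i + coeff (scaleP (- 1#) p) i   ≡⟨ cong (coeff p i +_) (coeff-scaleP (- 1#) p i) ⟩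
    coeff p i + - 1# * coeff p i            ≡⟨ cong (coeff p i +_) (-1*x≈-x _) ⟩
    coeff p i + - coeff p i                 ≡⟨ -‿inverseʳ _ ⟩
    0#                                      ∎
    where open ≡-Reasoning

  record Division {m} (d : Vec Carrier m) (l : Carrier) (p : Poly) : Set where
    constructor division
    field
      quotient  : Poly
      remainder : Vec Carrier m
      quotient-remainder : p ≋ quotient *P (Vec.toList d ++ [ l ]) +P Vec.toList remainder

  divide : ∀ {m} (d : Vec Carrier m) (l l⁻¹ : Carrier) → l⁻¹ * l ≡ 1# → (p : Poly) → Division d l p
  divide {m} d l l⁻¹ l⁻¹l≡1 [] =
    division [] (Vec.replicate m 0#) (≋-sym (replicate0≋[] m))
    where
    replicate0≋[] : ∀ m → Vec.toList (Vec.replicate m 0#) ≋ []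
    replicate0≋[] zero    = ≋-refl
    replicate0≋[] (suc m) = ≋-trans (∷-cong refl (replicate0≋[] m)) (≋-sym []≋[0])
  divide {m} d l l⁻¹ l⁻¹l≡1 (a ∷ p) with divide d l l⁻¹ l⁻¹l≡1 p
  ... | division Q R p≋QD+R = division (c ∷ Q) R′ a∷p≋
    where
    D = Vec.toList d ++ [ l ]
    w : Vec Carrier (suc m)
    w = a ∷ R
    c = Vec.last w * l⁻¹
    R′ = Vec.zipWith (λ x y → x + - (c * y)) (Vec.init w) d
    cl≡last : c * l ≡ Vec.last w
    cl≡last = trans (*-assoc _ l⁻¹ l) (trans (cong (Vec.last w *_) l⁻¹l≡1) (*-identityʳ _))
    subtract : ∀ {k} (u v : Vec Carrier k) →
      Vec.toList u ++ [ c * l ] ≋ scaleP c (Vec.toList v ++ [ l ]) +P Vec.toList (Vec.zipWith (λ x y → x + - (c * y)) u v)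
    subtract []      []      = ≋-refl
    subtract (x ∷ u) (y ∷ v) = ∷-cong x≡cy+[x-cy] (subtract u v)
      where
      x≡cy+[x-cy] : x ≡ c * y + (x + - (c * y))
      x≡cy+[x-cy] = sym (trans (cong (c * y +_) (+-comm x _)) (trans (sym (+-assoc _ _ x))
        (trans (cong (_+ x) (-‿inverseʳ _)) (+-identityˡ x))))
    w≡init++last : Vec.toList w ≡ Vec.toList (Vec.init w) ++ [ c * l ]
    w≡init++last = trans (cong Vec.toList (proj₂ (proj₂ (Vec.initLast w))))
      (trans (Vec.toList-∷ʳ (Vec.last w) (Vec.init w)) (cong (λ t → Vec.toList (Vec.init w) ++ [ t ]) (sym cl≡last)))
    a∷p≋ : a ∷ p ≋ (c ∷ Q) *P D +P Vec.toList R′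
    a∷p≋ = ≋-trans (∷-cong (sym (+-identityˡ a)) p≋QD+R) (≋-trans
      (+P-cong (≋-refl {0# ∷ (Q *P D)}) (≋-trans (≋-reflexive w≡init++last) (subtract (Vec.init w) d))) (≋-trans
      (≋-sym (+P-assoc (0# ∷ (Q *P D)) (scaleP c D) (Vec.toList R′)))
      (+P-cong (+P-comm (0# ∷ (Q *P D)) (scaleP c D)) ≋-refl)))

  coeff-beyond : ∀ p i → List.length p ≤ i → coeff p i ≡ 0#
  coeff-beyond []      i       _         = refl
  coeff-beyond (a ∷ p) (suc i) (s≤s le)  = coeff-beyond p i le

  coeff-∷ʳ : ∀ r x → coeff (r ++ [ x ]) (List.length r) ≡ x
  coeff-∷ʳ []      x = refl
  coeff-∷ʳ (a ∷ r) x = coeff-∷ʳ r x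

  length-∷ʳ : ∀ (r : Poly) x → List.length (r ++ [ x ]) ≡ suc (List.length r)
  length-∷ʳ []      x = refl
  length-∷ʳ (a ∷ r) x = cong suc (length-∷ʳ r x)

  deg-∷ʳ : ∀ (r : Poly) x → deg (r ++ [ x ]) ≡ List.length r
  deg-∷ʳ r x = cong (ℕ._∸ 1) (length-∷ʳ r x)

  monic-leading : ∀ {f} → Monic f → coeff f (deg f) ≡ 1#
  monic-leading (r , refl) = trans (cong (coeff (r ++ [ 1# ])) (deg-∷ʳ r 1#)) (coeff-∷ʳ r 1#)

  monic-beyond-deg : ∀ {f} → Monic f → ∀ i → deg f < i → coeff f i ≡ 0#
  monic-beyond-deg (r , refl) i deg<i =
    coeff-beyond (r ++ [ 1# ]) i (subst (_≤ i) (sym (length-∷ʳ r 1#)) (subst (_< i) (deg-∷ʳ r 1#) deg<i))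

  monic-≉[] : ∀ {f} → Monic f → ¬ f ≋ []
  monic-≉[] {f} monic (coeffwise f≈[]) = 0≢1 (trans (sym (f≈[] (deg f))) (monic-leading monic))

  monic-nonconstant : ∀ {f} → Monic f → 1 ≤ deg f → ¬ IsConstant f
  monic-nonconstant {f} monic 1≤deg constant with deg f | monic-leading monic
  ... | suc k | lead≡1 = 0≢1 (trans (sym (constant k)) lead≡1)

  -- Comparing leading coefficients forces both degrees, and then the scalar, to agree.
  monic-scalar-multiple : ∀ {f g w} → Monic f → Monic g → g ≋ scaleP w f → w ≡ 1#
  monic-scalar-multiple {f} {g} {w} mf mg g≋wf = compare (ℕ.<-cmp (deg f) (deg g))
    where
    open ≡-Reasoning
    g≡wf : ∀ i → coeff g i ≡ w * coeff f i
    g≡wf i = trans (coeff-≡ g≋wf i) (coeff-scaleP w f i)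
    1≡w*f[deg-g] : 1# ≡ w * coeff f (deg g)
    1≡w*f[deg-g] = trans (sym (monic-leading mg)) (g≡wf (deg g))
    compare : Tri (deg f < deg g) (deg f ≡ deg g) (deg g < deg f) → w ≡ 1#
    compare (tri< f<g _ _) = ⊥-elim (0≢1 (sym (begin
      1#                    ≡⟨ 1≡w*f[deg-g] ⟩
      w * coeff f (deg g)   ≡⟨ cong (w *_) (monic-beyond-deg mf (deg g) f<g) ⟩
      w * 0#                ≡⟨ zeroʳ w ⟩
      0#                    ∎)))
    compare (tri≈ _ f≡g _) = sym (begin
      1#                    ≡⟨ 1≡w*f[deg-g] ⟩
      w * coeff f (deg g)   ≡⟨ cong (λ i → w * coeff f i) (sym f≡g) ⟩
      w * coeff f (deg f)   ≡⟨ cong (w *_) (monic-leading mf) ⟩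
      w * 1#                ≡⟨ *-identityʳ w ⟩
      w                     ∎)
    compare (tri> _ _ g<f) = ⊥-elim (0≢1 (sym (begin
      1#                    ≡⟨ 1≡w*f[deg-g] ⟩
      w * coeff f (deg g)   ≡⟨ cong (_* coeff f (deg g)) w≡0 ⟩
      0# * coeff f (deg g)  ≡⟨ zeroˡ _ ⟩
      0#                    ∎)))
      where
      w≡0 : w ≡ 0#
      w≡0 = begin
        w                     ≡⟨ sym (*-identityʳ w) ⟩
        w * 1#                ≡⟨ cong (w *_) (sym (monic-leading mf)) ⟩
        w * coeff f (deg f)   ≡⟨ sym (g≡wf (deg f)) ⟩
        coeff g (deg f)       ≡⟨ monic-beyond-deg mg (deg f) g<f ⟩
        0#                    ∎

  constant≋[_] : ∀ a → IsConstant a → a ≋ [ coeff a 0 ]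
  constant≋[ [] ]    constant = coeffwise λ { zero → refl ; (suc i) → constant i }
  constant≋[ x ∷ a ] constant = coeffwise λ { zero → refl ; (suc i) → constant i }

  irreducible-∣-irreducible : ∀ {f g} → MonicIrreducible f → MonicIrreducible g → f ∣ g → f ≋ g
  irreducible-∣-irreducible {f} {g} (mf , 1≤deg-f , _) (mg , _ , irreducible-g) (v , vf≋g)
    with irreducible-g v f (coeff-≡ vf≋g)
  ... | inj₂ f-constant = ⊥-elim (monic-nonconstant mf 1≤deg-f f-constant)
  ... | inj₁ v-constant = ≋-sym (≋-trans g≋v₀f (≋-trans (scaleP-cong v₀≡1 ≋-refl) (scaleP-identity f)))
    where
    v₀ = coeff v 0
    g≋v₀f : g ≋ scaleP v₀ f
    g≋v₀f = ≋-trans (≋-sym vf≋g) (≋-trans (*P-congˡ f (constant≋[ v ] v-constant)) ([ v₀ ]*P f))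
    v₀≡1 : v₀ ≡ 1#
    v₀≡1 = monic-scalar-multiple mf mg g≋v₀f

  monomial-+ : ∀ a b → monomial a *P monomial b ≋ monomial (a ℕ.+ b)
  monomial-+ zero    b = *P-identityˡ (monomial b)
  monomial-+ (suc a) b = ≋-trans (0∷-*P (monomial a) (monomial b)) (∷-cong refl (monomial-+ a b))

  -1P+oneP≋[] : -1P +P oneP ≋ []
  -1P+oneP≋[] = coeffwise λ { zero → -‿inverseˡ 1# ; (suc i) → refl }

  xPowMinus1-+ : ∀ d b → monomial d *P xPowMinus1 b +P xPowMinus1 d ≋ xPowMinus1 (d ℕ.+ b)
  xPowMinus1-+ d b = begin
    monomial d *P (monomial b +P -1P) +P (monomial d +P -1P)
      ≈⟨ solve 3 (λ xᵈ xᵇ m → xᵈ :* (xᵇ :+ m) :+ (xᵈ :+ m) := (xᵈ :* xᵇ :+ m) :+ xᵈ :* (m :+ con 1))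
               ≋-refl (monomial d) (monomial b) -1P ⟩
    (monomial d *P monomial b +P -1P) +P monomial d *P (-1P +P oneP)
      ≈⟨ +P-cong (+P-cong (monomial-+ d b) ≋-refl) (*P-congʳ (monomial d) -1P+oneP≋[]) ⟩
    (monomial (d ℕ.+ b) +P -1P) +P monomial d *P []
      ≈⟨ +P-cong (≋-refl {xPowMinus1 (d ℕ.+ b)}) (*P-zeroʳ (monomial d)) ⟩
    (monomial (d ℕ.+ b) +P -1P) +P []
      ≈⟨ +P-identityʳ _ ⟩
    monomial (d ℕ.+ b) +P -1P ∎
    where open SetoidReasoning ≋-setoid

  ∣xPowMinus1-* : ∀ {h o} → h ∣ xPowMinus1 o → ∀ m → h ∣ xPowMinus1 (m ℕ.* o)
  ∣xPowMinus1-* {h} {o} h∣ zero    = ∣-respʳ (coeffwise λ { zero → sym (-‿inverseʳ 1#) ; (suc i) → refl }) (∣-[] h)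
  ∣xPowMinus1-* {h} {o} h∣ (suc m) =
    ∣-respʳ (xPowMinus1-+ o (m ℕ.* o)) (∣-+P (∣-*ˡ (monomial o) (∣xPowMinus1-* h∣ m)) h∣)

  ∣xPowMinus1-∸ : ∀ {h} d b → h ∣ xPowMinus1 (d ℕ.+ b) → h ∣ xPowMinus1 b → h ∣ xPowMinus1 d
  ∣xPowMinus1-∸ {h} d b h∣ h∣′ = ∣-respʳ cancel (∣-+P h∣ (∣-*ˡ -1P (∣-*ˡ (monomial d) h∣′)))
    where
    cancel : xPowMinus1 (d ℕ.+ b) +P -1P *P (monomial d *P xPowMinus1 b) ≋ xPowMinus1 d
    cancel = ≋-trans (+P-cong (≋-sym (xPowMinus1-+ d b)) ≋-refl) (≋-trans
      (solve 3 (λ X Y m → (X :+ Y) :+ m :* X := Y :+ (X :+ m :* X)) ≋-refl (monomial d *P xPowMinus1 b) (xPowMinus1 d) -1P)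
      (≋-trans (+P-cong (≋-refl {xPowMinus1 d}) (-1P-inverse (monomial d *P xPowMinus1 b))) (+P-identityʳ _)))

  order-∣ : ∀ {h o} → IsOrder h o → ∀ e → h ∣ xPowMinus1 e → o ℕ.∣ e
  order-∣ {h} {o@(suc _)} (_ , h∣xᵒ-1 , o-least) e h∣xᵉ-1 =
    ℕ.divides (e / o) (trans e≡ (cong (ℕ._+ e / o ℕ.* o) r≡0))
    where
    e≡ : e ≡ e % o ℕ.+ e / o ℕ.* o
    e≡ = m≡m%n+[m/n]*n e o
    h∣xʳ-1 : h ∣ xPowMinus1 (e % o)
    h∣xʳ-1 = ∣xPowMinus1-∸ (e % o) (e / o ℕ.* o) (subst (λ t → h ∣ xPowMinus1 t) e≡ h∣xᵉ-1)
                           (∣xPowMinus1-* (∣P⇒∣ h∣xᵒ-1) (e / o))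
    r≡0 : e % o ≡ 0
    r≡0 with e % o in r≡ | h∣xʳ-1
    ... | zero  | _ = refl
    ... | suc r | h∣ = ⊥-elim (ℕ.<⇒≱ (subst (_< o) r≡ (m%n<n e o)) (o-least (suc r) (s≤s z≤n) (∣⇒∣P h∣)))

module CoprimeFactors (F : Field) where
  open FieldProperties F
  open FieldDefs F
  open PolynomialSemiring F
  open PolynomialDivisibility F
  open PolynomialSolver using (solve; _:=_; _:+_; _:*_)

  Coprime : Poly → Poly → Set
  Coprime f g = ∃₂ λ u v → u *P f +P v *P g ≋ oneP

  coprime-oneP : ∀ f → Coprime f oneP
  coprime-oneP f = [] , oneP , *P-identityˡ oneP

  coprime-*P : ∀ {f g g′} → Coprime f g → Coprime f g′ → Coprime f (g *P g′)
  coprime-*P {f} {g} {g′} (u , v , uf+vg≋1) (u′ , v′ , u′f+v′g′≋1) =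
    u *P (u′ *P f +P v′ *P g′) +P v *P g *P u′ , v *P v′ , (begin
      (u *P (u′ *P f +P v′ *P g′) +P v *P g *P u′) *P f +P (v *P v′) *P (g *P g′)
        ≈⟨ solve 7 (λ u v f g u′ v′ g′ →
             (u :* (u′ :* f :+ v′ :* g′) :+ v :* g :* u′) :* f :+ (v :* v′) :* (g :* g′)
               := (u :* f :+ v :* g) :* (u′ :* f :+ v′ :* g′)) ≋-refl u v f g u′ v′ g′ ⟩
      (u *P f +P v *P g) *P (u′ *P f +P v′ *P g′)   ≈⟨ *P-cong uf+vg≋1 u′f+v′g′≋1 ⟩
      oneP *P oneP                                  ≈⟨ *P-identityˡ oneP ⟩
      oneP                                          ∎)
    where open SetoidReasoning ≋-setoid

  coprime-product : ∀ {k} f (g : Fin k → Poly) → (∀ j → Coprime f (g j)) → Coprime f (productP (tabulate g))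
  coprime-product {zero}  f g _        = coprime-oneP f
  coprime-product {suc k} f g coprime = coprime-*P (coprime Fin.zero) (coprime-product f (g ∘ Fin.suc) (coprime ∘ Fin.suc))

  coprime-∣ : ∀ {f g p} → Coprime f g → f ∣ p → g ∣ p → f *P g ∣ p
  coprime-∣ {f} {g} {p} (u , v , uf+vg≋1) (y , yf≋p) (x , xg≋p) = u *P x +P v *P y , (begin
    (u *P x +P v *P y) *P (f *P g)        ≈⟨ solve 6 (λ u v x y f g → (u :* x :+ v :* y) :* (f :* g)
                                                 := u :* f :* (x :* g) :+ v :* g :* (y :* f)) ≋-refl u v x y f g ⟩
    u *P f *P (x *P g) +P v *P g *P (y *P f) ≈⟨ +P-cong (*P-congʳ (u *P f) xg≋p) (*P-congʳ (v *P g) yf≋p) ⟩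
    u *P f *P p +P v *P g *P p              ≈⟨ solve 5 (λ u v f g p → u :* f :* p :+ v :* g :* p
                                                 := p :* (u :* f :+ v :* g)) ≋-refl u v f g p ⟩
    p *P (u *P f +P v *P g)                 ≈⟨ *P-congʳ p uf+vg≋1 ⟩
    p *P oneP                               ≈⟨ *P-identityʳ p ⟩
    p                                       ∎)
    where open SetoidReasoning ≋-setoid

  ∣-product : ∀ {k} (f : Fin k → Poly) j → f j ∣ productP (tabulate f)
  ∣-product {suc k} f Fin.zero    = ∣-*ʳ-self (f Fin.zero) (productP (tabulate (f ∘ Fin.suc)))
  ∣-product {suc k} f (Fin.suc j) = ∣-*ˡ (f Fin.zero) (∣-product (f ∘ Fin.suc) j)

  product-∣ : ∀ {k} (f : Fin k → Poly) {p} → (∀ i j → i ≢ j → Coprime (f i) (f j)) →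
              (∀ j → f j ∣ p) → productP (tabulate f) ∣ p
  product-∣ {zero}  f {p} _        _     = p , *P-identityʳ p
  product-∣ {suc k} f     coprime f∣p =
    coprime-∣ (coprime-product (f Fin.zero) (f ∘ Fin.suc) (λ j → coprime Fin.zero (Fin.suc j) λ ()))
              (f∣p Fin.zero)
              (product-∣ (f ∘ Fin.suc) (λ i j i≢j → coprime (Fin.suc i) (Fin.suc j) (i≢j ∘ Fin.suc-injective))
                         (f∣p ∘ Fin.suc))

module EuclideanAlgorithm (F : Field) (_≟_ : DecidableEquality (Field.Carrier F)) where
  open FieldProperties F
  open FieldDefs F
  open PolynomialSemiring F
  open PolynomialDivisibility F
  open CoprimeFactors F
  open PolynomialSolver using (solve; _:=_; _:+_; _:*_)

  data LeadingTerm {m} (r : Vec Carrier m) : Set where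
    vanishing : Vec.toList r ≋ [] → LeadingTerm r
    leading   : ∀ {k} → k < m → (r′ : Vec Carrier k) (l : Carrier) → l ≢ 0# →
                Vec.toList r ≋ Vec.toList r′ ++ [ l ] → LeadingTerm r

  leadingTerm : ∀ {m} (r : Vec Carrier m) → LeadingTerm r
  leadingTerm []      = vanishing ≋-refl
  leadingTerm (a ∷ r) with leadingTerm r
  ... | leading k<m r′ l l≢0 r≋ = leading (s≤s k<m) (a ∷ r′) l l≢0 (∷-cong refl r≋)
  ... | vanishing r≋[] with a ≟ 0#
  ...   | yes a≡0 = vanishing (≋-trans (∷-cong a≡0 r≋[]) (≋-sym []≋[0]))
  ...   | no  a≢0 = leading (s≤s z≤n) [] a a≢0 (∷-cong refl r≋[])

  record Gcd (p r : Poly) : Set where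
    constructor mkGcd
    field
      divisor a b : Poly
      bezout      : a *P p +P b *P r ≋ divisor
      divisor∣p   : divisor ∣ p
      divisor∣r   : divisor ∣ r

  gcd-remainder : ∀ {p Q D R} → p ≋ Q *P D +P R → Gcd D R → Gcd p D
  gcd-remainder {p} {Q} {D} {R} p≋QD+R (mkGcd d a b aD+bR≋d d∣D d∣R) =
    mkGcd d b (a +P -1P *P (b *P Q)) bezout (∣-respʳ (≋-sym p≋QD+R) (∣-+P (∣-*ˡ Q d∣D) d∣R)) d∣D
    where
    open SetoidReasoning ≋-setoid
    X = b *P Q *P D
    bezout : b *P p +P (a +P -1P *P (b *P Q)) *P D ≋ d
    bezout = begin
      b *P p +P (a +P -1P *P (b *P Q)) *P D
        ≈⟨ +P-cong (*P-congʳ b p≋QD+R) ≋-refl ⟩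
      b *P (Q *P D +P R) +P (a +P -1P *P (b *P Q)) *P D
        ≈⟨ solve 6 (λ a b Q D R m → b :* (Q :* D :+ R) :+ (a :+ m :* (b :* Q)) :* D
                                    := (a :* D :+ b :* R) :+ (b :* Q :* D :+ m :* (b :* Q :* D)))
                   ≋-refl a b Q D R -1P ⟩
      (a *P D +P b *P R) +P (X +P -1P *P X)
        ≈⟨ +P-cong aD+bR≋d (-1P-inverse X) ⟩
      d +P []
        ≈⟨ +P-identityʳ d ⟩
      d ∎

  gcd-vec : ∀ m (p : Poly) (r : Vec Carrier m) → Gcd p (Vec.toList r)
  gcd-vec = <-rec (λ m → ∀ p (r : Vec Carrier m) → Gcd p (Vec.toList r)) step
    where
    step : ∀ m → (∀ {k} → k < m → ∀ p (r : Vec Carrier k) → Gcd p (Vec.toList r)) →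
           ∀ p (r : Vec Carrier m) → Gcd p (Vec.toList r)
    step m rec p r with leadingTerm r
    ... | vanishing r≋[] = mkGcd p oneP [] (≋-trans (+P-identityʳ _) (*P-identityˡ p))
                                 (∣-refl p) (∣-respʳ (≋-sym r≋[]) (∣-[] p))
    ... | leading k<m r′ l l≢0 r≋ with inverseˡ l l≢0
    ...   | l⁻¹ , l⁻¹l≡1 with divide r′ l l⁻¹ l⁻¹l≡1 p
    ...     | division Q R p≋QD+R with gcd-remainder {Q = Q} p≋QD+R (rec k<m (Vec.toList r′ ++ [ l ]) R)
    ...       | mkGcd d a b bezout d∣p d∣D =
                mkGcd d a b (≋-trans (+P-cong ≋-refl (*P-congʳ b r≋)) bezout) d∣p (∣-respʳ (≋-sym r≋) d∣D)

  gcd-of : ∀ p r → Gcd p r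
  gcd-of p r = subst (Gcd p) (Vec.toList∘fromList r) (gcd-vec _ p (Vec.fromList r))

  constant-*P : ∀ {u} d → IsConstant u → u *P d ≋ scaleP (coeff u 0) d
  constant-*P {u} d u-constant = ≋-trans (*P-congˡ d (constant≋[ u ] u-constant)) ([ coeff u 0 ]*P d)

  -- The gcd d of f and g divides f, so d is either a unit, and Bézout scales to 1, or an associate of f,
  -- and then f ∣ g forces f ≋ g.
  irreducibles-coprime : ∀ {f g} → MonicIrreducible f → MonicIrreducible g → ¬ f ≋ g → Coprime f g
  irreducibles-coprime {f} {g} irr-f@(monic-f , _ , irreducible-f) irr-g f≉g with gcd-of f g
  ... | mkGcd d a b af+bg≋d (u , ud≋f) d∣g with irreducible-f u d (coeff-≡ ud≋f)
  ...   | inj₁ u-constant = ⊥-elim (f≉g (irreducible-∣-irreducible irr-f irr-g (∣-trans f∣d d∣g)))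
    where
    u₀ = coeff u 0
    f≋u₀d : f ≋ scaleP u₀ d
    f≋u₀d = ≋-trans (≋-sym ud≋f) (constant-*P {u} d u-constant)
    u₀≢0 : u₀ ≢ 0#
    u₀≢0 u₀≡0 = monic-≉[] monic-f (≋-trans f≋u₀d (≋-trans (scaleP-cong u₀≡0 ≋-refl) (scaleP-zero d)))
    u₀⁻¹ = proj₁ (inverseˡ u₀ u₀≢0)
    f∣d : f ∣ d
    f∣d = [ u₀⁻¹ ] , ≋-trans ([ u₀⁻¹ ]*P f) (≋-trans (scaleP-cong refl f≋u₀d) (≋-trans (scaleP-scaleP u₀⁻¹ u₀ d)
            (≋-trans (scaleP-cong (proj₂ (inverseˡ u₀ u₀≢0)) ≋-refl) (scaleP-identity d))))
  ...   | inj₂ d-constant = [ d₀⁻¹ ] *P a , [ d₀⁻¹ ] *P b , (begin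
    [ d₀⁻¹ ] *P a *P f +P [ d₀⁻¹ ] *P b *P g
      ≈⟨ solve 5 (λ c a b f g → c :* a :* f :+ c :* b :* g := c :* (a :* f :+ b :* g)) ≋-refl [ d₀⁻¹ ] a b f g ⟩
    [ d₀⁻¹ ] *P (a *P f +P b *P g)   ≈⟨ *P-congʳ [ d₀⁻¹ ] (≋-trans af+bg≋d d≋[d₀]) ⟩
    [ d₀⁻¹ ] *P [ d₀ ]               ≈⟨ [ d₀⁻¹ ]*P [ d₀ ] ⟩
    [ d₀⁻¹ * d₀ ]                    ≈⟨ ∷-cong (proj₂ (inverseˡ d₀ d₀≢0)) ≋-refl ⟩
    oneP                             ∎)
    where
    open SetoidReasoning ≋-setoid
    d₀ = coeff d 0
    d≋[d₀] : d ≋ [ d₀ ]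
    d≋[d₀] = constant≋[ d ] d-constant
    d₀≢0 : d₀ ≢ 0#
    d₀≢0 d₀≡0 = monic-≉[] monic-f (≋-trans (≋-sym ud≋f)
      (≋-trans (*P-congʳ u (≋-trans d≋[d₀] (≋-trans (∷-cong d₀≡0 ≋-refl) (≋-sym []≋[0])))) (*P-zeroʳ u)))
    d₀⁻¹ = proj₁ (inverseˡ d₀ d₀≢0)

  leading-coeff-*P : ∀ xs l rs →
    coeff ((xs ++ [ l ]) *P (rs ++ [ 1# ])) (List.length xs ℕ.+ List.length rs) ≡ l
  leading-coeff-*P []       l rs = begin
    coeff ([ l ] *P (rs ++ [ 1# ])) (List.length rs)   ≡⟨ coeff-≡ ([ l ]*P (rs ++ [ 1# ])) (List.length rs) ⟩
    coeff (scaleP l (rs ++ [ 1# ])) (List.length rs)   ≡⟨ coeff-scaleP l (rs ++ [ 1# ]) (List.length rs) ⟩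
    l * coeff (rs ++ [ 1# ]) (List.length rs)          ≡⟨ cong (l *_) (coeff-∷ʳ rs 1#) ⟩
    l * 1#                                             ≡⟨ *-identityʳ l ⟩
    l                                                  ∎
    where open ≡-Reasoning
  leading-coeff-*P (x ∷ xs) l rs = begin
    coeff (scaleP x R +P (0# ∷ ((xs ++ [ l ]) *P R))) (suc i)
      ≡⟨ coeff-+P (scaleP x R) (0# ∷ ((xs ++ [ l ]) *P R)) (suc i) ⟩
    coeff (scaleP x R) (suc i) + coeff ((xs ++ [ l ]) *P R) i
      ≡⟨ cong₂ _+_ (trans (coeff-scaleP x R (suc i)) (cong (x *_) (coeff-beyond R (suc i) R≤))) (leading-coeff-*P xs l rs) ⟩
    x * 0# + l
      ≡⟨ trans (cong (_+ l) (zeroʳ x)) (+-identityˡ l) ⟩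
    l ∎
    where
    open ≡-Reasoning
    R = rs ++ [ 1# ]
    i = List.length xs ℕ.+ List.length rs
    R≤ : List.length R ≤ suc i
    R≤ = subst (_≤ suc i) (sym (length-∷ʳ rs 1#)) (s≤s (ℕ.m≤n+m (List.length rs) (List.length xs)))

  monic-∤-oneP : ∀ {f} → Monic f → 1 ≤ deg f → ¬ f ∣ oneP
  monic-∤-oneP {f} (rs , refl) 1≤deg (u , uf≋1) with leadingTerm (Vec.fromList u)
  ... | vanishing u≋[] = 0≢1 (trans (sym (coeff-≡ (*P-zeroˡ f u≋[]′) 0)) (coeff-≡ uf≋1 0))
    where u≋[]′ = ≋-trans (≋-reflexive (sym (Vec.toList∘fromList u))) u≋[]
  ... | leading _ u′ l l≢0 u≋ = l≢0 (begin
    l                                                ≡⟨ sym (leading-coeff-*P (Vec.toList u′) l rs) ⟩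
    coeff ((Vec.toList u′ ++ [ l ]) *P f) i          ≡⟨ sym (coeff-≡ (*P-congˡ f u≋′) i) ⟩
    coeff (u *P f) i                                 ≡⟨ coeff-≡ uf≋1 i ⟩
    coeff oneP i                                     ≡⟨ oneP-beyond i 1≤i ⟩
    0#                                               ∎)
    where
    open ≡-Reasoning
    u≋′ = ≋-trans (≋-reflexive (sym (Vec.toList∘fromList u))) u≋
    i = List.length (Vec.toList u′) ℕ.+ List.length rs
    1≤i : 1 ≤ i
    1≤i = ℕ.≤-trans (subst (1 ≤_) (deg-∷ʳ rs 1#) 1≤deg) (ℕ.m≤n+m _ _)
    oneP-beyond : ∀ i → 1 ≤ i → coeff oneP i ≡ 0#
    oneP-beyond (suc i) _ = refl

module _ {X Y : Set} where
  last-map : ∀ {n} (f : X → Y) (u : Vec X (suc n)) → Vec.last (Vec.map f u) ≡ f (Vec.last u)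
  last-map {zero}  f (x ∷ []) = refl
  last-map {suc n} f (x ∷ u)  = last-map f u

  init-map : ∀ {n} (f : X → Y) (u : Vec X (suc n)) → Vec.init (Vec.map f u) ≡ Vec.map f (Vec.init u)
  init-map {zero}  f (x ∷ []) = refl
  init-map {suc n} f (x ∷ u)  = cong (f x ∷_) (init-map f u)

  last-zipWith : ∀ {n} (f : X → X → Y) (u v : Vec X (suc n)) →
                 Vec.last (Vec.zipWith f u v) ≡ f (Vec.last u) (Vec.last v)
  last-zipWith {zero}  f (x ∷ []) (y ∷ []) = refl
  last-zipWith {suc n} f (x ∷ u)  (y ∷ v)  = last-zipWith f u v

  init-zipWith : ∀ {n} (f : X → X → Y) (u v : Vec X (suc n)) →
                 Vec.init (Vec.zipWith f u v) ≡ Vec.zipWith f (Vec.init u) (Vec.init v)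
  init-zipWith {zero}  f (x ∷ []) (y ∷ []) = refl
  init-zipWith {suc n} f (x ∷ u)  (y ∷ v)  = cong (f x y ∷_) (init-zipWith f u v)

module CyclicAlgebra (F : Field) where
  open FieldProperties F
  open FieldDefs F
  open PolynomialSemiring F
  open ≡-Reasoning

  +A-comm : ∀ {n} (u v : A n) → u +A v ≡ v +A u
  +A-comm = Vec.zipWith-comm +-comm

  +A-assoc : ∀ {n} (u v w : A n) → (u +A v) +A w ≡ u +A (v +A w)
  +A-assoc = Vec.zipWith-assoc +-assoc

  +A-identityˡ : ∀ {n} (u : A n) → zeroA +A u ≡ u
  +A-identityˡ = Vec.zipWith-identityˡ +-identityˡ

  +A-identityʳ : ∀ {n} (u : A n) → u +A zeroA ≡ u
  +A-identityʳ = Vec.zipWith-identityʳ +-identityʳ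

  +A-interchange : ∀ {n} (u v w y : A n) → (u +A v) +A (w +A y) ≡ (u +A w) +A (v +A y)
  +A-interchange u v w y = begin
    (u +A v) +A (w +A y)  ≡⟨ +A-assoc u v (w +A y) ⟩
    u +A (v +A (w +A y))  ≡⟨ cong (u +A_) (sym (+A-assoc v w y)) ⟩
    u +A ((v +A w) +A y)  ≡⟨ cong (λ t → u +A (t +A y)) (+A-comm v w) ⟩
    u +A ((w +A v) +A y)  ≡⟨ cong (u +A_) (+A-assoc w v y) ⟩
    u +A (w +A (v +A y))  ≡⟨ sym (+A-assoc u w (v +A y)) ⟩
    (u +A w) +A (v +A y)  ∎

  ·A-zeroˡ : ∀ {n} (u : A n) → 0# ·A u ≡ zeroA
  ·A-zeroˡ []      = refl
  ·A-zeroˡ (x ∷ u) = cong₂ _∷_ (zeroˡ x) (·A-zeroˡ u)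

  ·A-zeroʳ : ∀ {n} a → a ·A zeroA {n} ≡ zeroA
  ·A-zeroʳ {zero}  a = refl
  ·A-zeroʳ {suc n} a = cong₂ _∷_ (zeroʳ a) (·A-zeroʳ a)

  ·A-distribˡ : ∀ {n} a (u v : A n) → a ·A (u +A v) ≡ (a ·A u) +A (a ·A v)
  ·A-distribˡ a []      []      = refl
  ·A-distribˡ a (x ∷ u) (y ∷ v) = cong₂ _∷_ (distribˡ a x y) (·A-distribˡ a u v)

  ·A-distribʳ : ∀ {n} a b (u : A n) → (a + b) ·A u ≡ (a ·A u) +A (b ·A u)
  ·A-distribʳ a b []      = refl
  ·A-distribʳ a b (x ∷ u) = cong₂ _∷_ (distribʳ x a b) (·A-distribʳ a b u)

  ·A-assoc : ∀ {n} a b (u : A n) → a ·A (b ·A u) ≡ (a * b) ·A u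
  ·A-assoc a b []      = refl
  ·A-assoc a b (x ∷ u) = cong₂ _∷_ (sym (*-assoc a b x)) (·A-assoc a b u)

  ·A-identity : ∀ {n} (u : A n) → 1# ·A u ≡ u
  ·A-identity []      = refl
  ·A-identity (x ∷ u) = cong₂ _∷_ (*-identityˡ x) (·A-identity u)

  -1·A-inverseˡ : ∀ {n} (u : A n) → ((- 1#) ·A u) +A u ≡ zeroA
  -1·A-inverseˡ []      = refl
  -1·A-inverseˡ (x ∷ u) = cong₂ _∷_ (trans (cong (_+ x) (-1*x≈-x x)) (-‿inverseˡ x)) (-1·A-inverseˡ u)

  mulX-+A : ∀ {n} (u v : A n) → mulX (u +A v) ≡ mulX u +A mulX v
  mulX-+A {zero}  u v = refl
  mulX-+A {suc n} u v = cong₂ _∷_ (last-zipWith _+_ u v) (init-zipWith _+_ u v)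

  mulX-·A : ∀ {n} a (u : A n) → mulX (a ·A u) ≡ a ·A mulX u
  mulX-·A {zero}  a u = refl
  mulX-·A {suc n} a u = cong₂ _∷_ (last-map (a *_) u) (init-map (a *_) u)

  mulX-zeroA : ∀ {n} → mulX (zeroA {n}) ≡ zeroA
  mulX-zeroA {zero}  = refl
  mulX-zeroA {suc n} = trans (cong mulX (sym (·A-zeroˡ (zeroA {suc n}))))
                         (trans (mulX-·A 0# zeroA) (·A-zeroˡ _))

  mulX-injective : ∀ {n} {u v : A n} → mulX u ≡ mulX v → u ≡ v
  mulX-injective {zero}          xu≡xv = xu≡xv
  mulX-injective {suc n} {u} {v} xu≡xv = begin
    u                              ≡⟨ proj₂ (proj₂ (Vec.initLast u)) ⟩
    Vec.init u Vec.∷ʳ Vec.last u   ≡⟨ cong₂ Vec._∷ʳ_ (cong Vec.tail xu≡xv) (cong Vec.head xu≡xv) ⟩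
    Vec.init v Vec.∷ʳ Vec.last v   ≡⟨ sym (proj₂ (proj₂ (Vec.initLast v))) ⟩
    v                              ∎

  mulXPow-+ : ∀ {n} i j (u : A n) → mulXPow (i ℕ.+ j) u ≡ mulXPow i (mulXPow j u)
  mulXPow-+ zero    j u = refl
  mulXPow-+ (suc i) j u = cong mulX (mulXPow-+ i j u)

  mulXPow-·A : ∀ {n} j a (u : A n) → mulXPow j (a ·A u) ≡ a ·A mulXPow j u
  mulXPow-·A zero    a u = refl
  mulXPow-·A (suc j) a u = trans (cong mulX (mulXPow-·A j a u)) (mulX-·A a (mulXPow j u))

  act-≋[] : ∀ {n} p (z : A n) → p ≋ [] → act p z ≡ zeroA
  act-≋[] []      z _             = refl
  act-≋[] (a ∷ p) z (coeffwise e) = begin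
    (a ·A z) +A mulX (act p z)  ≡⟨ cong₂ _+A_ (trans (cong (_·A z) (e zero)) (·A-zeroˡ z))
                                              (trans (cong mulX (act-≋[] p z (coeffwise λ i → e (suc i)))) mulX-zeroA) ⟩
    zeroA +A zeroA              ≡⟨ +A-identityˡ zeroA ⟩
    zeroA                       ∎

  act-cong : ∀ {n} {p r} (z : A n) → p ≋ r → act p z ≡ act r z
  act-cong {p = []}    {r}     z e = sym (act-≋[] r z (≋-sym e))
  act-cong {p = a ∷ p} {[]}    z e = act-≋[] (a ∷ p) z e
  act-cong {p = a ∷ p} {b ∷ r} z (coeffwise e) =
    cong₂ _+A_ (cong (_·A z) (e zero)) (cong mulX (act-cong {p = p} {r} z (coeffwise λ i → e (suc i))))

  act-+P : ∀ {n} p r (z : A n) → act (p +P r) z ≡ act p z +A act r z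
  act-+P []      r       z = sym (+A-identityˡ (act r z))
  act-+P (a ∷ p) []      z = sym (+A-identityʳ _)
  act-+P (a ∷ p) (b ∷ r) z = trans
    (cong₂ _+A_ (·A-distribʳ a b z) (trans (cong mulX (act-+P p r z)) (mulX-+A (act p z) (act r z))))
    (+A-interchange _ _ _ _)

  act-scaleP : ∀ {n} a p (z : A n) → act (scaleP a p) z ≡ a ·A act p z
  act-scaleP a []      z = sym (·A-zeroʳ a)
  act-scaleP a (b ∷ p) z = trans
    (cong₂ _+A_ (sym (·A-assoc a b z)) (trans (cong mulX (act-scaleP a p z)) (mulX-·A a (act p z))))
    (sym (·A-distribˡ a (b ·A z) (mulX (act p z))))

  act-0∷ : ∀ {n} p (z : A n) → act (0# ∷ p) z ≡ mulX (act p z)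
  act-0∷ p z = trans (cong (_+A mulX (act p z)) (·A-zeroˡ z)) (+A-identityˡ _)

  act-*P : ∀ {n} p r (z : A n) → act (p *P r) z ≡ act p (act r z)
  act-*P []      r z = refl
  act-*P (a ∷ p) r z = trans (act-+P (scaleP a r) (0# ∷ (p *P r)) z)
    (cong₂ _+A_ (act-scaleP a r z) (trans (act-0∷ (p *P r) z) (cong mulX (act-*P p r z))))

  act-·A : ∀ {n} p b (u : A n) → act p (b ·A u) ≡ b ·A act p u
  act-·A []      b u = sym (·A-zeroʳ b)
  act-·A (a ∷ p) b u = trans
    (cong₂ _+A_ (trans (·A-assoc a b u) (trans (cong (_·A u) (*-comm a b)) (sym (·A-assoc b a u))))
                (trans (cong mulX (act-·A p b u)) (mulX-·A b _)))
    (sym (·A-distribˡ b _ _))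

  act-zeroA : ∀ {n} p → act p (zeroA {n}) ≡ zeroA
  act-zeroA p = begin
    act p zeroA             ≡⟨ cong (act p) (sym (·A-zeroˡ zeroA)) ⟩
    act p (0# ·A zeroA)     ≡⟨ act-·A p 0# zeroA ⟩
    0# ·A act p zeroA       ≡⟨ ·A-zeroˡ _ ⟩
    zeroA                   ∎

  act-oneP : ∀ {n} (z : A n) → act oneP z ≡ z
  act-oneP z = trans (cong₂ _+A_ (·A-identity z) mulX-zeroA) (+A-identityʳ z)

  act-monomial : ∀ {n} j (z : A n) → act (monomial j) z ≡ mulXPow j z
  act-monomial zero    z = act-oneP z
  act-monomial (suc j) z = trans (act-0∷ (monomial j) z) (cong mulX (act-monomial j z))

  act-mulX : ∀ {n} p (z : A n) → act p (mulX z) ≡ mulX (act p z)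
  act-mulX p z = begin
    act p (mulX z)                 ≡⟨ cong (act p) (sym (act-monomial 1 z)) ⟩
    act p (act (monomial 1) z)     ≡⟨ sym (act-*P p (monomial 1) z) ⟩
    act (p *P monomial 1) z        ≡⟨ act-cong z (*P-comm p (monomial 1)) ⟩
    act (monomial 1 *P p) z        ≡⟨ act-*P (monomial 1) p z ⟩
    act (monomial 1) (act p z)     ≡⟨ act-monomial 1 (act p z) ⟩
    mulX (act p z)                 ∎

  act-xPowMinus1 : ∀ {n} e (z : A n) → act (xPowMinus1 e) z ≡ mulXPow e z +A ((- 1#) ·A z)
  act-xPowMinus1 e z = trans (act-+P (monomial e) [ - 1# ] z)
    (cong₂ _+A_ (act-monomial e z) (trans (cong (((- 1#) ·A z) +A_) mulX-zeroA) (+A-identityʳ _)))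

  periodic⇒annihilated : ∀ {n} e (z : A n) → mulXPow e z ≡ z → act (xPowMinus1 e) z ≡ zeroA
  periodic⇒annihilated e z xᵉz≡z = begin
    act (xPowMinus1 e) z            ≡⟨ act-xPowMinus1 e z ⟩
    mulXPow e z +A ((- 1#) ·A z)    ≡⟨ cong (_+A ((- 1#) ·A z)) xᵉz≡z ⟩
    z +A ((- 1#) ·A z)              ≡⟨ +A-comm z _ ⟩
    ((- 1#) ·A z) +A z              ≡⟨ -1·A-inverseˡ z ⟩
    zeroA                           ∎

  annihilated⇒periodic : ∀ {n} e (z : A n) → act (xPowMinus1 e) z ≡ zeroA → mulXPow e z ≡ z
  annihilated⇒periodic e z annihilated = begin
    mulXPow e z                             ≡⟨ sym (+A-identityʳ _) ⟩
    mulXPow e z +A zeroA                    ≡⟨ cong (mulXPow e z +A_) (sym (-1·A-inverseˡ z)) ⟩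
    mulXPow e z +A (((- 1#) ·A z) +A z)     ≡⟨ sym (+A-assoc _ _ _) ⟩
    (mulXPow e z +A ((- 1#) ·A z)) +A z     ≡⟨ cong (_+A z) (trans (sym (act-xPowMinus1 e z)) annihilated) ⟩
    zeroA +A z                              ≡⟨ +A-identityˡ z ⟩
    z                                       ∎

∣-lcmList : ∀ {k} (o : Fin k → ℕ) j → o j ℕ.∣ lcmList (tabulate o)
∣-lcmList {suc k} o Fin.zero    = m∣lcm[m,n] (o Fin.zero) _
∣-lcmList {suc k} o (Fin.suc j) = ℕ.∣-trans (∣-lcmList (o ∘ Fin.suc) j) (n∣lcm[m,n] (o Fin.zero) _)

lcmList-least : ∀ {k} (o : Fin k → ℕ) {e} → (∀ j → o j ℕ.∣ e) → lcmList (tabulate o) ℕ.∣ e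
lcmList-least {zero}  o {e} _      = ℕ.1∣ e
lcmList-least {suc k} o     o∣e = lcm-least (o∣e Fin.zero) (lcmList-least (o ∘ Fin.suc) (o∣e ∘ Fin.suc))

lcmList-nonzero : ∀ {k} (o : Fin k → ℕ) → (∀ j → NonZero (o j)) → NonZero (lcmList (tabulate o))
lcmList-nonzero {zero}  o _   = _
lcmList-nonzero {suc k} o o≢0 = ℕ.≢-nonZero λ lcm≡0 → ℕ.≢-nonZero⁻¹ (m ℕ.* r) {{m*r≢0}} (begin
  m ℕ.* r                  ≡⟨ sym (gcd*lcm m r) ⟩
  gcd m r ℕ.* lcm m r      ≡⟨ cong (gcd m r ℕ.*_) lcm≡0 ⟩
  gcd m r ℕ.* 0            ≡⟨ ℕ.*-zeroʳ (gcd m r) ⟩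
  0                        ∎)
  where
  open ≡-Reasoning
  m = o Fin.zero
  r = lcmList (tabulate (o ∘ Fin.suc))
  m*r≢0 = ℕ.m*n≢0 m r {{o≢0 Fin.zero}} {{lcmList-nonzero (o ∘ Fin.suc) (o≢0 ∘ Fin.suc)}}

module MinimalPolynomials (F : Field) (_≟_ : DecidableEquality (Field.Carrier F)) where
  open FieldProperties F
  open FieldDefs F
  open PolynomialSemiring F
  open PolynomialDivisibility F
  open CoprimeFactors F
  open EuclideanAlgorithm F _≟_
  open CyclicAlgebra F
  open ≡-Reasoning

  act-remainder : ∀ {n p Q D R} (z : A n) → p ≋ Q *P D +P R → act D z ≡ zeroA → act p z ≡ zeroA → act R z ≡ zeroA
  act-remainder {p = p} {Q} {D} {R} z p≋QD+R Dz≡0 pz≡0 = begin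
    act R z                      ≡⟨ sym (+A-identityˡ _) ⟩
    zeroA +A act R z             ≡⟨ cong (_+A act R z) (sym (trans (act-*P Q D z) (trans (cong (act Q) Dz≡0) (act-zeroA Q)))) ⟩
    act (Q *P D) z +A act R z    ≡⟨ sym (act-+P (Q *P D) R z) ⟩
    act (Q *P D +P R) z          ≡⟨ sym (act-cong z p≋QD+R) ⟩
    act p z                      ≡⟨ pz≡0 ⟩
    zeroA                        ∎

  monic-annihilator : ∀ {n k} {z : A n} (r : Vec Carrier k) l → l ≢ 0# → act (Vec.toList r ++ [ l ]) z ≡ zeroA →
                      ∃[ c ] (Monic c × deg c ≡ k × act c z ≡ zeroA)
  monic-annihilator {z = z} r l l≢0 rz≡0 =
    c , (Vec.toList (Vec.map (l⁻¹ *_) r) , refl) , trans (deg-∷ʳ (Vec.toList (Vec.map (l⁻¹ *_) r)) 1#) (Vec.length-toList (Vec.map (l⁻¹ *_) r)) , cz≡0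
    where
    l⁻¹ = proj₁ (inverseˡ l l≢0)
    c = Vec.toList (Vec.map (l⁻¹ *_) r) ++ [ 1# ]
    c≡ : scaleP l⁻¹ (Vec.toList r ++ [ l ]) ≡ c
    c≡ = trans (List.map-++ (l⁻¹ *_) (Vec.toList r) [ l ])
               (cong₂ _++_ (sym (Vec.toList-map (l⁻¹ *_) r)) (cong [_] (proj₂ (inverseˡ l l≢0))))
    cz≡0 : act c z ≡ zeroA
    cz≡0 = begin
      act c z                                    ≡⟨ cong (λ t → act t z) (sym c≡) ⟩
      act (scaleP l⁻¹ (Vec.toList r ++ [ l ])) z ≡⟨ act-scaleP l⁻¹ (Vec.toList r ++ [ l ]) z ⟩
      l⁻¹ ·A act (Vec.toList r ++ [ l ]) z       ≡⟨ cong (l⁻¹ ·A_) rz≡0 ⟩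
      l⁻¹ ·A zeroA                               ≡⟨ ·A-zeroʳ l⁻¹ ⟩
      zeroA                                      ∎

  -- A nonzero remainder of p modulo c would yield a monic annihilator of z of smaller degree.
  minPoly-∣ : ∀ {n c} {z : A n} → IsMinPoly c z → ∀ p → act p z ≡ zeroA → c ∣ p
  minPoly-∣ {z = z} ((rs , refl) , cz≡0 , c-least) p pz≡0
    with List.length rs | Vec.fromList rs | Vec.toList∘fromList rs
  ... | _ | d | refl with divide d 1# 1# (*-identityˡ 1#) p
  ...   | division Q R p≋Qc+R with leadingTerm R
  ...     | vanishing R≋[] = Q , ≋-sym (≋-trans p≋Qc+R (≋-trans (+P-cong ≋-refl R≋[]) (+P-identityʳ _)))
  ...     | leading k<m r l l≢0 R≋
            with monic-annihilator r l l≢0 (trans (act-cong z (≋-sym R≋)) (act-remainder {Q = Q} z p≋Qc+R cz≡0 pz≡0))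
  ...       | c′ , monic′ , deg-c′≡k , c′z≡0 = ⊥-elim (ℕ.<⇒≱ deg-c′<deg-c (c-least c′ monic′ c′z≡0))
    where
    deg-c′<deg-c : deg c′ < deg (Vec.toList d ++ [ 1# ])
    deg-c′<deg-c = subst₂ _<_ (sym deg-c′≡k) (sym (trans (deg-∷ʳ (Vec.toList d) 1#) (Vec.length-toList d))) k<m

  periodic⇒minPoly-∣ : ∀ {n c} {z : A n} → IsMinPoly c z → ∀ e → mulXPow e z ≡ z → c ∣ xPowMinus1 e
  periodic⇒minPoly-∣ minPoly e xᵉz≡z = minPoly-∣ minPoly (xPowMinus1 e) (periodic⇒annihilated e _ xᵉz≡z)

  minPoly-∣⇒periodic : ∀ {n c} {z : A n} → IsMinPoly c z → ∀ e → c ∣ xPowMinus1 e → mulXPow e z ≡ z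
  minPoly-∣⇒periodic {c = c} {z} (_ , cz≡0 , _) e (u , uc≋xᵉ-1) = annihilated⇒periodic e z (begin
    act (xPowMinus1 e) z    ≡⟨ act-cong z (≋-sym uc≋xᵉ-1) ⟩
    act (u *P c) z          ≡⟨ act-*P u c z ⟩
    act u (act c z)         ≡⟨ cong (act u) cz≡0 ⟩
    act u zeroA             ≡⟨ act-zeroA u ⟩
    zeroA                   ∎)

  minPoly-mulX : ∀ {n c} {z : A n} → IsMinPoly c z → IsMinPoly c (mulX z)
  minPoly-mulX {c = c} {z} (monic , cz≡0 , c-least) =
    monic , trans (act-mulX c z) (trans (cong mulX cz≡0) mulX-zeroA) ,
    λ c′ monic′ c′xz≡0 → c-least c′ monic′ (mulX-injective (trans (sym (act-mulX c′ z)) (trans c′xz≡0 (sym mulX-zeroA))))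

  minPoly-·A : ∀ {n c} {z : A n} a → a ≢ 0# → IsMinPoly c z → IsMinPoly c (a ·A z)
  minPoly-·A {c = c} {z} a a≢0 (monic , cz≡0 , c-least) =
    monic , trans (act-·A c a z) (trans (cong (a ·A_) cz≡0) (·A-zeroʳ a)) ,
    λ c′ monic′ c′az≡0 → c-least c′ monic′ (cancel c′ c′az≡0)
    where
    a⁻¹ = proj₁ (inverseˡ a a≢0)
    cancel : ∀ c′ → act c′ (a ·A z) ≡ zeroA → act c′ z ≡ zeroA
    cancel c′ c′az≡0 = begin
      act c′ z                    ≡⟨ sym (·A-identity _) ⟩
      1# ·A act c′ z              ≡⟨ cong (_·A act c′ z) (sym (proj₂ (inverseˡ a a≢0))) ⟩
      (a⁻¹ * a) ·A act c′ z       ≡⟨ sym (·A-assoc a⁻¹ a _) ⟩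
      a⁻¹ ·A (a ·A act c′ z)      ≡⟨ cong (a⁻¹ ·A_) (trans (sym (act-·A c′ a z)) c′az≡0) ⟩
      a⁻¹ ·A zeroA                ≡⟨ ·A-zeroʳ a⁻¹ ⟩
      zeroA                       ∎

  minPoly-nonzero : ∀ {n c} {z : A n} → IsMinPoly c z → 1 ≤ deg c → z ≢ zeroA
  minPoly-nonzero (_ , _ , c-least) 1≤deg refl = ℕ.<⇒≱ 1≤deg (c-least oneP ([] , refl) (act-zeroA oneP))

  inIdeal-mulX : ∀ {n g} {z : A n} → InIdeal g z → InIdeal g (mulX z)
  inIdeal-mulX {g = g} (a , z≡ag) =
    monomial 1 *P a , trans (cong mulX z≡ag) (trans (sym (act-monomial 1 _)) (sym (act-*P (monomial 1) a (toA g))))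

  inIdeal-·A : ∀ {n g} {z : A n} α → InIdeal g z → InIdeal g (α ·A z)
  inIdeal-·A {g = g} α (a , z≡ag) = scaleP α a , trans (cong (α ·A_) z≡ag) (sym (act-scaleP α a (toA g)))

  module _ {k} (f : Fin k → Poly) (ord : Fin k → ℕ) (isOrder : ∀ j → IsOrder (f j) (ord j)) where

    product-∣xPowMinus1⇒ : ∀ e → productP (tabulate f) ∣ xPowMinus1 e → lcmList (tabulate ord) ℕ.∣ e
    product-∣xPowMinus1⇒ e c∣ = lcmList-least ord λ j → order-∣ (isOrder j) e (∣-trans (∣-product f j) c∣)

    ⇒product-∣xPowMinus1 : (∀ j → MonicIrreducible (f j)) → (∀ i j → f i ≋ f j → i ≡ j) →
                           ∀ e → lcmList (tabulate ord) ℕ.∣ e → productP (tabulate f) ∣ xPowMinus1 e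
    ⇒product-∣xPowMinus1 irreducible distinct e lcm∣e = product-∣ f coprime f∣xᵉ-1
      where
      coprime : ∀ i j → i ≢ j → Coprime (f i) (f j)
      coprime i j i≢j = irreducibles-coprime (irreducible i) (irreducible j) (i≢j ∘ distinct i j)
      f∣xᵉ-1 : ∀ j → f j ∣ xPowMinus1 e
      f∣xᵉ-1 j with ℕ.∣-trans (∣-lcmList ord j) lcm∣e
      ... | ℕ.divides m refl = ∣xPowMinus1-* (∣P⇒∣ (proj₁ (proj₂ (isOrder j)))) m

    minPoly-period-∣ : ∀ {n} {z : A n} → IsMinPoly (productP (tabulate f)) z →
                       ∀ e → mulXPow e z ≡ z → lcmList (tabulate ord) ℕ.∣ e
    minPoly-period-∣ minPoly e periodic = product-∣xPowMinus1⇒ e (periodic⇒minPoly-∣ minPoly e periodic)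

    minPoly-periodic : (∀ j → MonicIrreducible (f j)) → (∀ i j → f i ≋ f j → i ≡ j) →
                       ∀ {n} {z : A n} → IsMinPoly (productP (tabulate f)) z → mulXPow (lcmList (tabulate ord)) z ≡ z
    minPoly-periodic irreducible distinct minPoly =
      minPoly-∣⇒periodic minPoly _ (⇒product-∣xPowMinus1 irreducible distinct _ ℕ.∣-refl)

  product-positive-degree : ∀ {k} (f : Fin k → Poly) → (∀ j → MonicIrreducible (f j)) → 1 ≤ k →
                            Monic (productP (tabulate f)) → 1 ≤ deg (productP (tabulate f))
  product-positive-degree f irreducible 1≤k (x ∷ xs , c≡) = subst (1 ≤_) (sym (trans (cong deg c≡) (deg-∷ʳ (x ∷ xs) 1#))) (s≤s z≤n)
  product-positive-degree f irreducible 1≤k ([] , c≡)     =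
    ⊥-elim (monic-∤-oneP (proj₁ (irreducible j)) (proj₁ (proj₂ (irreducible j))) (∣-respʳ (≋-reflexive c≡) (∣-product f j)))
    where j = Fin.fromℕ< 1≤k

×-injective⇒≤ : ∀ {a b c d} {f : Fin a × Fin b → Fin c × Fin d} → Injective _≡_ _≡_ f → a ℕ.* b ≤ c ℕ.* d
×-injective⇒≤ {a} {b} {c} {d} {f} f-injective = Fin.injective⇒≤ g-injective
  where
  module AB = Inverse (Fin.*↔× {a} {b})
  module CD = Inverse (Fin.*↔× {c} {d})
  g-injective : Injective _≡_ _≡_ (CD.from ∘ f ∘ AB.to)
  g-injective {x} {y} gx≡gy = trans (sym (AB.strictlyInverseʳ x)) (trans (cong AB.from
    (f-injective (trans (sym (CD.strictlyInverseˡ _)) (trans (cong CD.to gx≡gy) (CD.strictlyInverseˡ _)))))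
    (AB.strictlyInverseʳ y))

record Enumeration {m} (P : Fin m → Set) : Set where
  field
    size              : ℕ
    element           : Fin size → Fin m
    element-P         : ∀ k → P (element k)
    element-injective : Injective _≡_ _≡_ element
    position          : ∀ i → P i → Fin size
    element-position  : ∀ i p → element (position i p) ≡ i

  size-≡ : (∀ i → P i) → size ≡ m
  size-≡ all = ℕ.≤-antisym (Fin.injective⇒≤ element-injective) (Fin.injective⇒≤ position-injective)
    where
    position-injective : Injective _≡_ _≡_ (λ i → position i (all i))
    position-injective {i} {j} e = trans (sym (element-position i (all i))) (trans (cong element e) (element-position j (all j)))

  size-positive : ∀ i → P i → 1 ≤ size
  size-positive i p with size | position i p
  ... | suc _ | _ = s≤s z≤n

size-< : ∀ {m} {P : Fin m → Set} (E : Enumeration P) i → ¬ P i → Enumeration.size E < m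
size-< {suc m} {P} E i ¬Pi = s≤s (Fin.injective⇒≤ {f = λ k → punchOut (i≢element k)} punchOut-injective)
  where
  open Enumeration E
  i≢element : ∀ k → i ≢ element k
  i≢element k i≡ = ¬Pi (subst P (sym i≡) (element-P k))
  punchOut-injective : Injective _≡_ _≡_ (λ k → punchOut (i≢element k))
  punchOut-injective e = element-injective (Fin.punchOut-injective (i≢element _) (i≢element _) e)

enumerate : ∀ {m} {P : Fin m → Set} → Decidable P → Enumeration P
enumerate {zero}  P? = record
  { size = 0 ; element = λ () ; element-P = λ () ; element-injective = λ {} ; position = λ () ; element-position = λ () }
enumerate {suc m} {P} P? with enumerate {m} {P ∘ Fin.suc} (P? ∘ Fin.suc) | P? Fin.zero
... | E | yes P0 = record
  { size = suc size ; element = element′ ; element-P = element-P′ ; element-injective = injective′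
  ; position = position′ ; element-position = element-position′ }
  where
  open Enumeration E
  element′ : Fin (suc size) → Fin (suc m)
  element′ Fin.zero    = Fin.zero
  element′ (Fin.suc k) = Fin.suc (element k)
  element-P′ : ∀ k → P (element′ k)
  element-P′ Fin.zero    = P0
  element-P′ (Fin.suc k) = element-P k
  injective′ : Injective _≡_ _≡_ element′
  injective′ {Fin.zero}  {Fin.zero}  _ = refl
  injective′ {Fin.suc x} {Fin.suc y} e = cong Fin.suc (element-injective (Fin.suc-injective e))
  position′ : ∀ i → P i → Fin (suc size)
  position′ Fin.zero    _ = Fin.zero
  position′ (Fin.suc i) p = Fin.suc (position i p)
  element-position′ : ∀ i p → element′ (position′ i p) ≡ i
  element-position′ Fin.zero    _ = refl
  element-position′ (Fin.suc i) p = cong Fin.suc (element-position i p)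
... | E | no ¬P0 = record
  { size = size ; element = Fin.suc ∘ element ; element-P = element-P
  ; element-injective = element-injective ∘ Fin.suc-injective
  ; position = position′ ; element-position = element-position′ }
  where
  open Enumeration E
  position′ : ∀ i → P i → Fin size
  position′ Fin.zero    p = ⊥-elim (¬P0 p)
  position′ (Fin.suc i) p = position i p
  element-position′ : ∀ i p → Fin.suc (element (position′ i p)) ≡ i
  element-position′ Fin.zero    p = ⊥-elim (¬P0 p)
  element-position′ (Fin.suc i) p = cong Fin.suc (element-position i p)

module NonzeroScalars (F : Field) {q₁ : ℕ} (enum : HasSize F (suc q₁)) where
  open Field F
  open Inverse enum using (to; from; strictlyInverseˡ; strictlyInverseʳ)

  -- The field elements are enumerated by Fin (suc q₁); removing the index of 0# leaves the nonzero ones.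
  nonzero : Fin q₁ → Carrier
  nonzero k = to (punchIn (from 0#) k)

  nonzero-≢0 : ∀ k → nonzero k ≢ 0#
  nonzero-≢0 k e = Fin.punchInᵢ≢i (from 0#) k (trans (sym (strictlyInverseʳ _)) (cong from e))

  nonzero-injective : Injective _≡_ _≡_ nonzero
  nonzero-injective {k} {k′} e =
    Fin.punchIn-injective (from 0#) k k′ (trans (sym (strictlyInverseʳ _)) (trans (cong from e) (strictlyInverseʳ _)))

  index : ∀ α → α ≢ 0# → Fin q₁
  index α α≢0 = punchOut {i = from 0#} {j = from α} (α≢0 ∘ from-injective ∘ sym)
    where
    from-injective : ∀ {x y} → from x ≡ from y → x ≡ y
    from-injective {x} {y} e = trans (sym (strictlyInverseˡ x)) (trans (cong to e) (strictlyInverseˡ y))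

  nonzero-index : ∀ α α≢0 → nonzero (index α α≢0) ≡ α
  nonzero-index α α≢0 = trans (cong to (Fin.punchIn-punchOut _)) (strictlyInverseˡ α)

module _ {X : Set} {P : X → Set} (P? : Decidable P) where

  count-∷ʳ : ∀ {m} (xs : Vec X m) y → Vec.count P? (xs Vec.∷ʳ y) ≡ Vec.count P? (y ∷ xs)
  count-∷ʳ []       y = refl
  count-∷ʳ (x ∷ xs) y rewrite count-∷ʳ xs y with does (P? x) | does (P? y)
  ... | true  | true  = refl
  ... | true  | false = refl
  ... | false | true  = refl
  ... | false | false = refl

  count-map : ∀ {Y : Set} {Q : Y → Set} (Q? : Decidable Q) (f : Y → X) → (∀ y → P (f y) → Q y) → (∀ y → Q y → P (f y)) →
              ∀ {m} (ys : Vec Y m) → Vec.count P? (Vec.map f ys) ≡ Vec.count Q? ys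
  count-map Q? f P⇒Q Q⇒P []       = refl
  count-map Q? f P⇒Q Q⇒P (y ∷ ys) =
    cong₂ (λ b → if b then suc else id) (does-⇔ (mk⇔ (P⇒Q y) (Q⇒P y)) (P? (f y)) (Q? y))
          (count-map Q? f P⇒Q Q⇒P ys)

module HammingWeight (F : Field) {q : ℕ} (enum : HasSize F q) where
  open FieldProperties F
  open FieldDefs F

  ≢0? : Decidable (_≢ 0#)
  ≢0? a = ¬? (_≟F_ enum a 0#)

  weight-mulX : ∀ {m} (v : A m) → weight enum (mulX v) ≡ weight enum v
  weight-mulX {zero}  v = refl
  weight-mulX {suc m} v = trans (sym (count-∷ʳ ≢0? (Vec.init v) (Vec.last v)))
                                (cong (weight enum) (sym (proj₂ (proj₂ (Vec.initLast v)))))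

  weight-mulXPow : ∀ {m} j (v : A m) → weight enum (mulXPow j v) ≡ weight enum v
  weight-mulXPow zero    v = refl
  weight-mulXPow (suc j) v = trans (weight-mulX (mulXPow j v)) (weight-mulXPow j v)

  weight-·A : ∀ {m} α → α ≢ 0# → (v : A m) → weight enum (α ·A v) ≡ weight enum v
  weight-·A α α≢0 = count-map ≢0? ≢0? (α *_)
    (λ x αx≢0 x≡0 → αx≢0 (trans (cong (α *_) x≡0) (zeroʳ α)))
    (λ x x≢0 → *-nonzero α≢0 x≢0)

record ProperSubcount (L Q s R : ℕ) : Set where
  field
    a b     : ℕ
    a*L≡b*Q : a ℕ.* L ≡ b ℕ.* Q
    1≤a     : 1 ≤ a
    a<s     : a < s
    1≤b     : 1 ≤ b
    b<R     : b < R

lcm≤common-multiple : ∀ {m n c} .{{_ : NonZero c}} → m ℕ.∣ c → n ℕ.∣ c → lcm m n ≤ c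
lcm≤common-multiple m∣c n∣c = ℕ.∣⇒≤ (lcm-least m∣c n∣c)

[m/?gcd]*n≡lcm : ∀ m n .{{_ : NonZero m}} → (m /? gcd m n) ℕ.* n ≡ lcm m n
[m/?gcd]*n≡lcm m n with gcd m n | gcd*lcm m n | gcd[m,n]∣m m n | gcd[m,n]≢0 m n (inj₁ (ℕ.≢-nonZero⁻¹ m))
... | zero  | _        | _     | gcd≢0 = ⊥-elim (gcd≢0 refl)
... | suc d | gcd*lcm≡ | gcd∣m | _     = ℕ.*-cancelˡ-≡ _ _ (suc d) (begin
  suc d ℕ.* (m / suc d ℕ.* n)    ≡⟨ x*[y*z]≡[y*x]*z (suc d) (m / suc d) n ⟩
  m / suc d ℕ.* suc d ℕ.* n      ≡⟨ cong (ℕ._* n) (m/n*n≡m gcd∣m) ⟩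
  m ℕ.* n                        ≡⟨ sym gcd*lcm≡ ⟩
  suc d ℕ.* lcm m n              ∎)
  where
  open ≡-Reasoning
  x*[y*z]≡[y*x]*z : ∀ x y z → x ℕ.* (y ℕ.* z) ≡ y ℕ.* x ℕ.* z
  x*[y*z]≡[y*x]*z = solve-∀

module _ {L Q s R : ℕ} .{{_ : NonZero L}} .{{_ : NonZero Q}} where

  -- s L = lcm(Q, L) is the least positive common multiple, but a L is a smaller one.
  subcount-excluded-by-bc : s ≡ Q /? gcd Q L → ¬ ProperSubcount L Q s R
  subcount-excluded-by-bc s≡Q/d proper = ℕ.<⇒≱ a<s (ℕ.*-cancelʳ-≤ s a L (begin
    s ℕ.* L              ≡⟨ cong (ℕ._* L) s≡Q/d ⟩
    (Q /? gcd Q L) ℕ.* L ≡⟨ [m/?gcd]*n≡lcm Q L ⟩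
    lcm Q L              ≤⟨ lcm≤common-multiple (ℕ.divides b a*L≡b*Q) (ℕ.n∣m*n a) ⟩
    a ℕ.* L              ∎))
    where
    open ProperSubcount proper
    open ℕ.≤-Reasoning
    instance _ = ℕ.m*n≢0 a L {{ℕ.>-nonZero 1≤a}}

  subcount-excluded-by-rc : L /? gcd Q L ≡ R → ¬ ProperSubcount L Q s R
  subcount-excluded-by-rc L/d≡R proper = ℕ.<⇒≱ b<R (ℕ.*-cancelʳ-≤ R b Q (begin
    R ℕ.* Q              ≡⟨ cong (ℕ._* Q) (trans (sym L/d≡R) (cong (L /?_) (gcd-comm Q L))) ⟩
    (L /? gcd L Q) ℕ.* Q ≡⟨ [m/?gcd]*n≡lcm L Q ⟩
    lcm L Q              ≡⟨ lcm-comm L Q ⟩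
    lcm Q L              ≤⟨ lcm≤common-multiple (ℕ.n∣m*n b) (ℕ.divides a (sym a*L≡b*Q)) ⟩
    b ℕ.* Q              ∎))
    where
    open ProperSubcount proper
    open ℕ.≤-Reasoning
    instance _ = ℕ.m*n≢0 b Q {{ℕ.>-nonZero 1≤b}}

  -- From s L = R Q and a L = b Q we get s b = R a, so s divides a when gcd(s, R) = 1.
  subcount-excluded-by-coprimality : s ℕ.* L ≡ R ℕ.* Q → gcd s R ≡ 1 → ¬ ProperSubcount L Q s R
  subcount-excluded-by-coprimality sL≡RQ gcd≡1 proper =
    ℕ.<⇒≱ a<s (ℕ.∣⇒≤ {{ℕ.>-nonZero 1≤a}} (coprime-divisor (gcd≡1⇒coprime gcd≡1) (ℕ.divides b (trans (sym sb≡Ra) (ℕ.*-comm s b)))))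
    where
    open ProperSubcount proper
    open ≡-Reasoning
    x*[y*z]≡y*[x*z] : ∀ x y z → x ℕ.* (y ℕ.* z) ≡ y ℕ.* (x ℕ.* z)
    x*[y*z]≡y*[x*z] = solve-∀
    sb≡Ra : s ℕ.* b ≡ R ℕ.* a
    sb≡Ra = ℕ.*-cancelʳ-≡ _ _ Q (begin
      s ℕ.* b ℕ.* Q     ≡⟨ ℕ.*-assoc s b Q ⟩
      s ℕ.* (b ℕ.* Q)   ≡⟨ cong (s ℕ.*_) (sym a*L≡b*Q) ⟩
      s ℕ.* (a ℕ.* L)   ≡⟨ x*[y*z]≡y*[x*z] s a L ⟩
      a ℕ.* (s ℕ.* L)   ≡⟨ cong (a ℕ.*_) sL≡RQ ⟩
      a ℕ.* (R ℕ.* Q)   ≡⟨ x*[y*z]≡y*[x*z] a R Q ⟩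
      R ℕ.* (a ℕ.* Q)   ≡⟨ sym (ℕ.*-assoc R a Q) ⟩
      R ℕ.* a ℕ.* Q     ∎)

  no-proper-subcount : s ℕ.* L ≡ R ℕ.* Q →
    (s ≡ Q /? gcd Q L × 1 < Q /? gcd Q L × Q /? gcd Q L ≤ Q) ⊎ L /? gcd Q L ≡ R ⊎ gcd s R ≡ 1 →
    ¬ ProperSubcount L Q s R
  no-proper-subcount sL≡RQ =
    [ (λ (s≡ , _) → subcount-excluded-by-bc s≡)
    , [ subcount-excluded-by-rc , subcount-excluded-by-coprimality sL≡RQ ]′ ]′

module OrbitCounting (F : Field) {q₁ : ℕ} (enum : HasSize F (suc q₁)) where
  open FieldProperties F
  open FieldDefs F
  open CyclicAlgebra F
  open NonzeroScalars F enum
  open HammingWeight F enum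
  open ≡-Reasoning

  ·A-cancelʳ : ∀ {m α β} (u : A m) → u ≢ zeroA → α ·A u ≡ β ·A u → α ≡ β
  ·A-cancelʳ []      u≢0 _ = ⊥-elim (u≢0 refl)
  ·A-cancelʳ {α = α} {β} (x ∷ u) x∷u≢0 αu≡βu with _≟F_ enum x 0#
  ... | yes x≡0 = ·A-cancelʳ u (x∷u≢0 ∘ cong₂ _∷_ x≡0) (cong Vec.tail αu≡βu)
  ... | no  x≢0 with inverseˡ x x≢0
  ...   | x⁻¹ , x⁻¹x≡1 = begin
    α              ≡⟨ sym (*-identityʳ α) ⟩
    α * 1#         ≡⟨ cong (α *_) (sym xx⁻¹≡1) ⟩
    α * (x * x⁻¹)  ≡⟨ sym (*-assoc α x x⁻¹) ⟩
    α * x * x⁻¹    ≡⟨ cong (_* x⁻¹) (cong Vec.head αu≡βu) ⟩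
    β * x * x⁻¹    ≡⟨ *-assoc β x x⁻¹ ⟩
    β * (x * x⁻¹)  ≡⟨ cong (β *_) xx⁻¹≡1 ⟩
    β * 1#         ≡⟨ *-identityʳ β ⟩
    β              ∎
    where xx⁻¹≡1 = trans (*-comm x x⁻¹) x⁻¹x≡1

  InCycle-trans : ∀ {n} {u v w : A n} → InCycle u v → InCycle v w → InCycle u w
  InCycle-trans {u = u} (i , v≡) (j , w≡) = j ℕ.+ i , trans w≡ (trans (cong (mulXPow j) v≡) (sym (mulXPow-+ j i u)))

  InPropClass-sym : ∀ {n} {u v : A n} → InPropClass u v → InPropClass v u
  InPropClass-sym {u = u} {v} (α , α≢0 , v≡αu) with inverseˡ α α≢0
  ... | α⁻¹ , α⁻¹α≡1 = α⁻¹ , inverse-nonzero α⁻¹α≡1 , (begin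
    u                ≡⟨ sym (·A-identity u) ⟩
    1# ·A u          ≡⟨ cong (_·A u) (sym α⁻¹α≡1) ⟩
    (α⁻¹ * α) ·A u   ≡⟨ sym (·A-assoc α⁻¹ α u) ⟩
    α⁻¹ ·A (α ·A u)  ≡⟨ cong (α⁻¹ ·A_) (sym v≡αu) ⟩
    α⁻¹ ·A v         ∎)

  InPropClass-trans : ∀ {n} {u v w : A n} → InPropClass u v → InPropClass v w → InPropClass u w
  InPropClass-trans {u = u} (α , α≢0 , v≡) (β , β≢0 , w≡) =
    β * α , *-nonzero β≢0 α≢0 , trans w≡ (trans (cong (β ·A_) v≡) (·A-assoc β α u))

  samePropClass : ∀ {n} {u v : A n} → InPropClass u v → SameClass InPropClass u v
  samePropClass uv _ = InPropClass-trans (InPropClass-sym uv) , InPropClass-trans uv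

  ·A-reflect : ∀ {n} {T : A n → Set} → (∀ {u} α → α ≢ 0# → T u → T (α ·A u)) →
               ∀ {α u} → α ≢ 0# → T (α ·A u) → T u
  ·A-reflect {T = T} T-·A α≢0 Tαu with InPropClass-sym (_ , α≢0 , refl)
  ... | β , β≢0 , u≡βαu = subst T (sym u≡βαu) (T-·A β β≢0 Tαu)

  module PeriodicInvariantSet {n} (C : A n → Set)
           (C-mulX     : ∀ {z} → C z → C (mulX z))
           (C-·A       : ∀ {z} α → α ≢ 0# → C z → C (α ·A z))
           (C-nonzero  : ∀ {z} → C z → NonZeroA z)
           (L : ℕ) .{{_ : NonZero L}}
           (C-periodic : ∀ {z} → C z → mulXPow L z ≡ z)
           (C-period-∣ : ∀ {z} → C z → ∀ e → mulXPow e z ≡ z → L ℕ.∣ e)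
           where

    C-mulXPow : ∀ {z} j → C z → C (mulXPow j z)
    C-mulXPow zero    Cz = Cz
    C-mulXPow (suc j) Cz = C-mulX (C-mulXPow j Cz)

    mulXPow-*L : ∀ {z} → C z → ∀ m → mulXPow (m ℕ.* L) z ≡ z
    mulXPow-*L     Cz zero    = refl
    mulXPow-*L {z} Cz (suc m) =
      trans (mulXPow-+ L (m ℕ.* L) z) (trans (cong (mulXPow L) (mulXPow-*L Cz m)) (C-periodic Cz))

    mulXPow-% : ∀ {z} → C z → ∀ j → mulXPow j z ≡ mulXPow (j % L) z
    mulXPow-% {z} Cz j = begin
      mulXPow j z                                ≡⟨ cong (λ t → mulXPow t z) (m≡m%n+[m/n]*n j L) ⟩
      mulXPow (j % L ℕ.+ j / L ℕ.* L) z          ≡⟨ mulXPow-+ (j % L) (j / L ℕ.* L) z ⟩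
      mulXPow (j % L) (mulXPow (j / L ℕ.* L) z)  ≡⟨ cong (mulXPow (j % L)) (mulXPow-*L Cz (j / L)) ⟩
      mulXPow (j % L) z                          ∎

    mulXPow-reduce : ∀ {z} → C z → ∀ j → ∃[ k ] (mulXPow j z ≡ mulXPow (toℕ {L} k) z)
    mulXPow-reduce {z} Cz j =
      fromℕ< (m%n<n j L) , trans (mulXPow-% Cz j) (cong (λ t → mulXPow t z) (sym (Fin.toℕ-fromℕ< (m%n<n j L))))

    InCycle-sym : ∀ {v w} → C v → InCycle v w → InCycle w v
    InCycle-sym {v} {w} Cv (j , w≡) = L ℕ.∸ j % L , sym (begin
      mulXPow (L ℕ.∸ j % L) w                    ≡⟨ cong (mulXPow (L ℕ.∸ j % L)) (trans w≡ (mulXPow-% Cv j)) ⟩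
      mulXPow (L ℕ.∸ j % L) (mulXPow (j % L) v)  ≡⟨ sym (mulXPow-+ (L ℕ.∸ j % L) (j % L) v) ⟩
      mulXPow (L ℕ.∸ j % L ℕ.+ j % L) v          ≡⟨ cong (λ t → mulXPow t v) (ℕ.m∸n+n≡m (ℕ.<⇒≤ (m%n<n j L))) ⟩
      mulXPow L v                                ≡⟨ C-periodic Cv ⟩
      v                                          ∎)

    sameCycle : ∀ {u v} → C u → InCycle u v → SameClass InCycle u v
    sameCycle Cu uv _ = InCycle-trans (InCycle-sym Cu uv) , InCycle-trans uv

    mulXPow-injective-≤ : ∀ {v} → C v → ∀ {j j′} → j ≤ j′ → j′ < L → mulXPow j v ≡ mulXPow j′ v → j ≡ j′
    mulXPow-injective-≤ {v} Cv {j} {j′} j≤j′ j′<L xʲv≡xʲ′v =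
      trans (sym (ℕ.+-identityˡ j)) (trans (cong (ℕ._+ j) (sym d≡0)) (ℕ.m∸n+n≡m j≤j′))
      where
      periodic : mulXPow (j′ ℕ.∸ j) (mulXPow j v) ≡ mulXPow j v
      periodic = trans (sym (mulXPow-+ (j′ ℕ.∸ j) j v))
                       (trans (cong (λ t → mulXPow t v) (ℕ.m∸n+n≡m j≤j′)) (sym xʲv≡xʲ′v))
      d≡0 : j′ ℕ.∸ j ≡ 0
      d≡0 with j′ ℕ.∸ j | C-period-∣ (C-mulXPow j Cv) (j′ ℕ.∸ j) periodic | ℕ.≤-<-trans (ℕ.m∸n≤m j′ j) j′<L
      ... | zero  | _   | _   = refl
      ... | suc d | L∣d | d<L = ⊥-elim (ℕ.>⇒∤ d<L L∣d)

    mulXPow-injective : ∀ {v} → C v → Injective _≡_ _≡_ (λ (j : Fin L) → mulXPow (toℕ j) v)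
    mulXPow-injective Cv {j} {j′} e with ℕ.≤-total (toℕ j) (toℕ j′)
    ... | inj₁ j≤j′ = Fin.toℕ-injective (mulXPow-injective-≤ Cv j≤j′ (Fin.toℕ<n j′) e)
    ... | inj₂ j′≤j = Fin.toℕ-injective (sym (mulXPow-injective-≤ Cv j′≤j (Fin.toℕ<n j) (sym e)))

    Orbit : A n → A n → Set
    Orbit z u = ∃[ α ] (α ≢ 0# × ∃[ j ] (u ≡ α ·A mulXPow j z))

    orbit-refl : ∀ z → Orbit z z
    orbit-refl z = 1# , 1≢0 , 0 , sym (·A-identity z)

    orbit-C : ∀ {z u} → C z → Orbit z u → C u
    orbit-C Cz (α , α≢0 , j , u≡) = subst C (sym u≡) (C-·A α α≢0 (C-mulXPow j Cz))

    orbit-mulXPow : ∀ {z u} i → Orbit z u → Orbit z (mulXPow i u)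
    orbit-mulXPow {z} i (α , α≢0 , j , u≡) = α , α≢0 , i ℕ.+ j ,
      trans (cong (mulXPow i) u≡) (trans (mulXPow-·A i α (mulXPow j z)) (cong (α ·A_) (sym (mulXPow-+ i j z))))

    orbit-·A : ∀ {z u} β → β ≢ 0# → Orbit z u → Orbit z (β ·A u)
    orbit-·A β β≢0 (α , α≢0 , j , u≡) = β * α , *-nonzero β≢0 α≢0 , j , trans (cong (β ·A_) u≡) (·A-assoc β α _)

    orbit? : ∀ {z} → C z → Decidable (Orbit z)
    orbit? {z} Cz u
      with Fin.any? (λ m → Fin.any? (λ (j : Fin L) → Vec.≡-dec (_≟F_ enum) u (nonzero m ·A mulXPow (toℕ j) z)))
    ... | yes (m , j , u≡) = yes (nonzero m , nonzero-≢0 m , toℕ j , u≡)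
    ... | no ∄ = no λ (α , α≢0 , j , u≡) →
      ∄ (index α α≢0 , proj₁ (mulXPow-reduce Cz j) ,
         trans u≡ (cong₂ _·A_ (sym (nonzero-index α α≢0)) (proj₂ (mulXPow-reduce Cz j))))

    orbit-weight : ∀ {z u} → Orbit z u → weight enum u ≡ weight enum z
    orbit-weight {z} (α , α≢0 , j , refl) = trans (weight-·A α α≢0 (mulXPow j z)) (weight-mulXPow j z)

    module Counted {s R : ℕ} (cycles  : ClassCount InCycle     NonZeroA C s)
                             (classes : ClassCount InPropClass NonZeroA C R) where

      cycleRep : Fin s → A n
      cycleRep = Vec.lookup (proj₁ cycles)

      classRep : Fin R → A n
      classRep = Vec.lookup (proj₁ classes)

      cycleRep-C : ∀ i → C (cycleRep i)
      cycleRep-C i = proj₁ (proj₂ (proj₂ cycles)) i (cycleRep i) (0 , refl)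

      classRep-C : ∀ i → C (classRep i)
      classRep-C i = proj₁ (proj₂ (proj₂ classes)) i (classRep i) (1# , 1≢0 , sym (·A-identity _))

      cycle-coordinates : ∀ {u} → C u → Σ (Fin s) λ i → Σ (Fin L) λ j → u ≡ mulXPow (toℕ j) (cycleRep i)
      cycle-coordinates {u} Cu
        with proj₂ (proj₂ (proj₂ (proj₂ cycles))) u (C-nonzero Cu) (λ v (j , v≡) → subst C (sym v≡) (C-mulXPow j Cu))
      ... | i , same with proj₁ (same u) (0 , refl)
      ...   | j , u≡ = i , proj₁ (mulXPow-reduce (cycleRep-C i) j) , trans u≡ (proj₂ (mulXPow-reduce (cycleRep-C i) j))

      class-coordinates : ∀ {u} → C u → Σ (Fin R) λ i → Σ (Fin q₁) λ m → u ≡ nonzero m ·A classRep i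
      class-coordinates {u} Cu
        with proj₂ (proj₂ (proj₂ (proj₂ classes))) u (C-nonzero Cu) (λ v (α , α≢0 , v≡) → subst C (sym v≡) (C-·A α α≢0 Cu))
      ... | i , same with proj₁ (same u) (1# , 1≢0 , sym (·A-identity u))
      ...   | α , α≢0 , u≡ = i , index α α≢0 , trans u≡ (cong (_·A classRep i) (sym (nonzero-index α α≢0)))

      cycle-coordinates-unique : ∀ {i i′ j j′} → mulXPow (toℕ j) (cycleRep i) ≡ mulXPow (toℕ j′) (cycleRep i′) →
                                 i ≡ i′ × j ≡ j′
      cycle-coordinates-unique {i} {i′} {j} {j′} e
        with proj₁ (proj₂ (proj₂ (proj₂ cycles))) i i′
               (sameCycle (cycleRep-C i) (InCycle-trans (toℕ j , refl) (InCycle-sym (cycleRep-C i′) (toℕ j′ , e))))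
      ... | refl = refl , mulXPow-injective (cycleRep-C i) e

      class-coordinates-unique : ∀ {i i′ m m′} → nonzero m ·A classRep i ≡ nonzero m′ ·A classRep i′ →
                                 i ≡ i′ × m ≡ m′
      class-coordinates-unique {i} {i′} {m} {m′} e
        with proj₁ (proj₂ (proj₂ (proj₂ classes))) i i′
               (samePropClass (InPropClass-trans (nonzero m , nonzero-≢0 m , refl)
                                                 (InPropClass-sym (nonzero m′ , nonzero-≢0 m′ , e))))
      ... | refl = refl , nonzero-injective (·A-cancelʳ (classRep i) (proj₁ (proj₂ classes) i) e)

      -- A set T ⊆ C stable under x and the nonzero scalars is a disjoint union of a cycles of size L
      -- and of b proportionality classes of size q₁, so a L = b q₁.
      module StableCount (T : A n → Set) (T⊆C : ∀ {u} → T u → C u)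
                         (T-mulXPow : ∀ {u} j → T u → T (mulXPow j u))
                         (T-·A : ∀ {u} α → α ≢ 0# → T u → T (α ·A u))
                         (T-cycleRep? : Decidable (T ∘ cycleRep))
                         (T-classRep? : Decidable (T ∘ classRep)) where

        module Cycles  = Enumeration (enumerate T-cycleRep?)
        module Classes = Enumeration (enumerate T-classRep?)

        cycleElement : Fin Cycles.size × Fin L → A n
        cycleElement (k , j) = mulXPow (toℕ j) (cycleRep (Cycles.element k))

        classElement : Fin Classes.size × Fin q₁ → A n
        classElement (k , m) = nonzero m ·A classRep (Classes.element k)

        cycleElement-injective : Injective _≡_ _≡_ cycleElement
        cycleElement-injective {k , j} {k′ , j′} e with cycle-coordinates-unique {j = j} {j′} e
        ... | i≡i′ , refl = cong (_, j) (Cycles.element-injective i≡i′)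

        classElement-injective : Injective _≡_ _≡_ classElement
        classElement-injective {k , m} {k′ , m′} e with class-coordinates-unique {m = m} {m′} e
        ... | i≡i′ , refl = cong (_, m) (Classes.element-injective i≡i′)

        toClass : ∀ x → Σ (Fin Classes.size × Fin q₁) λ y → classElement y ≡ cycleElement x
        toClass x@(k , j) with class-coordinates (T⊆C (T-mulXPow (toℕ j) (Cycles.element-P k)))
        ... | i , m , u≡ = (Classes.position i Ti , m) ,
                           trans (cong (λ t → nonzero m ·A classRep t) (Classes.element-position i Ti)) (sym u≡)
          where Ti = ·A-reflect {T = T} T-·A (nonzero-≢0 m) (subst T u≡ (T-mulXPow (toℕ j) (Cycles.element-P k)))

        toCycle : ∀ y → Σ (Fin Cycles.size × Fin L) λ x → cycleElement x ≡ classElement y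
        toCycle y@(k , m) with cycle-coordinates (T⊆C (T-·A (nonzero m) (nonzero-≢0 m) (Classes.element-P k)))
        ... | i , j , u≡ = (Cycles.position i Ti , j) ,
                           trans (cong (λ t → mulXPow (toℕ j) (cycleRep t)) (Cycles.element-position i Ti)) (sym u≡)
          where
          Ti : T (cycleRep i)
          Ti with InCycle-sym (cycleRep-C i) (toℕ j , u≡)
          ... | d , i≡ = subst T (sym i≡) (T-mulXPow d (T-·A (nonzero m) (nonzero-≢0 m) (Classes.element-P k)))

        count-≡ : Cycles.size ℕ.* L ≡ Classes.size ℕ.* q₁
        count-≡ = ℕ.≤-antisym
          (×-injective⇒≤ {f = proj₁ ∘ toClass} λ {x} {y} e → cycleElement-injective
            (trans (sym (proj₂ (toClass x))) (trans (cong classElement e) (proj₂ (toClass y)))))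
          (×-injective⇒≤ {f = proj₁ ∘ toCycle} λ {x} {y} e → classElement-injective
            (trans (sym (proj₂ (toCycle x))) (trans (cong cycleElement e) (proj₂ (toCycle y)))))

      cycles-classes-count : s ℕ.* L ≡ R ℕ.* q₁
      cycles-classes-count =
        subst₂ (λ a b → a ℕ.* L ≡ b ℕ.* q₁) (Cycles.size-≡ cycleRep-C) (Classes.size-≡ classRep-C) count-≡
        where
        open StableCount C (λ Cu → Cu) C-mulXPow C-·A (yes ∘ cycleRep-C) (yes ∘ classRep-C)

      orbit-or-proper-subcount : ∀ {z w} → C z → C w → Orbit z w ⊎ ProperSubcount L q₁ s R
      orbit-or-proper-subcount {z} {w} Cz Cw with orbit? Cz w
      ... | yes zw = inj₁ zw
      ... | no ¬zw = inj₂ record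
        { a = Cycles.size ; b = Classes.size ; a*L≡b*Q = count-≡
        ; 1≤a = size-positive-cycles ; a<s = size-< (enumerate cyc?) (proj₁ w-cycle) ¬orbit-cycleRep-w
        ; 1≤b = size-positive-classes ; b<R = size-< (enumerate cls?) (proj₁ w-class) ¬orbit-classRep-w }
        where
        cyc? = λ i → orbit? Cz (cycleRep i)
        cls? = λ i → orbit? Cz (classRep i)
        open StableCount (Orbit z) (orbit-C Cz) orbit-mulXPow orbit-·A cyc? cls?
        size-positive-cycles : 1 ≤ Cycles.size
        size-positive-cycles with cycle-coordinates Cz
        ... | i , j , z≡ with InCycle-sym (cycleRep-C i) (toℕ j , z≡)
        ...   | d , i≡ = Cycles.size-positive i (subst (Orbit z) (sym i≡) (orbit-mulXPow d (orbit-refl z)))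
        size-positive-classes : 1 ≤ Classes.size
        size-positive-classes with class-coordinates Cz
        ... | i , m , z≡ = Classes.size-positive i
                             (·A-reflect {T = Orbit z} orbit-·A (nonzero-≢0 m) (subst (Orbit z) z≡ (orbit-refl z)))
        w-cycle = cycle-coordinates Cw
        w-class = class-coordinates Cw
        ¬orbit-cycleRep-w : ¬ Orbit z (cycleRep (proj₁ w-cycle))
        ¬orbit-cycleRep-w o = ¬zw (subst (Orbit z) (sym (proj₂ (proj₂ w-cycle))) (orbit-mulXPow (toℕ (proj₁ (proj₂ w-cycle))) o))
        ¬orbit-classRep-w : ¬ Orbit z (classRep (proj₁ w-class))
        ¬orbit-classRep-w o = ¬zw (subst (Orbit z) (sym (proj₂ (proj₂ w-class)))
                                        (orbit-·A (nonzero m) (nonzero-≢0 m) o))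
          where m = proj₁ (proj₂ w-class)

corollary7 :
  (q : ℕ) (F : Field) (enum : HasSize F q) → IsPrimePower q → 2 < q →
  let open FieldDefs F in
  (n : ℕ) → 1 ≤ n → gcd n q ≡ 1 →
  -- h = h_1 ⋯ h_t, distinct monic irreducibles; J = ⟨(x^n - 1)/h⟩ = ⟨g⟩
  (t : ℕ) (h : Fin t → Poly) →
  (∀ i → MonicIrreducible (h i)) →
  (∀ i i′ → h i ≈P h i′ → i ≡ i′) →
  (g : Poly) → g *P productP (tabulate h) ≈P xPowMinus1 n →
  -- c = h_{i_1} ⋯ h_{i_k}, k > 1
  (k : ℕ) → 1 < k → (ι : Fin k → Fin t) → Injective _≡_ _≡_ ι →
  (ord : Fin k → ℕ) → (∀ j → IsOrder (h (ι j)) (ord j)) →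
  (∀ j → ord j ≢ q ^ deg (h (ι j)) ∸ 1) →
  let c  = productP (tabulate (h ∘ ι))
      nc = lcmList (tabulate ord)
      dc = gcd (q ∸ 1) nc
      rc = nc /? dc
      bc = (q ∸ 1) /? dc
      C  = λ (z : A n) → InIdeal g z × IsMinPoly c z
  in
  (s R : ℕ) →
  ClassCount InCycle NonZeroA C s →
  ClassCount InPropClass NonZeroA C R →
  ((s ≡ bc × 1 < bc × bc ≤ q ∸ 1) ⊎ rc ≡ R ⊎ gcd s R ≡ 1) →
  ∀ z w → C z → C w → weight enum z ≡ weight enum w
corollary7 (suc (suc (suc q″))) F enum _ (s≤s (s≤s (s≤s z≤n))) n _ _ t h irreducible distinct g _ k 1<k ι ι-injective ord isOrder _
           s R cycles classes condition z w Cz Cw =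
  [ sym ∘ orbit-weight , ⊥-elim ∘ no-proper-subcount cycles-classes-count condition ]′ (orbit-or-proper-subcount Cz Cw)
  where
  open FieldDefs F
  open PolynomialSemiring F using (_≋_; coeff-≡)
  open MinimalPolynomials F (_≟F_ enum)
  f = h ∘ ι
  c = productP (tabulate f)
  nc = lcmList (tabulate ord)
  C : A n → Set
  C u = InIdeal g u × IsMinPoly c u
  instance
    nc≢0 : NonZero nc
    nc≢0 = lcmList-nonzero ord λ j → ℕ.>-nonZero (proj₁ (isOrder j))
  f-distinct : ∀ i j → f i ≋ f j → i ≡ j
  f-distinct i j fi≋fj = ι-injective (distinct (ι i) (ι j) (coeff-≡ fi≋fj))
  C-periodic : ∀ {u} → C u → mulXPow nc u ≡ u
  C-periodic (_ , minPoly) = minPoly-periodic f ord isOrder (irreducible ∘ ι) f-distinct minPoly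
  C-period-∣ : ∀ {u} → C u → ∀ e → mulXPow e u ≡ u → nc ℕ.∣ e
  C-period-∣ (_ , minPoly) = minPoly-period-∣ f ord isOrder minPoly
  C-nonzero : ∀ {u} → C u → NonZeroA u
  C-nonzero (_ , minPoly) = minPoly-nonzero minPoly (product-positive-degree f (irreducible ∘ ι) (ℕ.<⇒≤ 1<k) (proj₁ minPoly))
  open OrbitCounting F enum
  open PeriodicInvariantSet C (λ (inJ , minPoly) → inIdeal-mulX {g = g} inJ , minPoly-mulX minPoly)
                              (λ α α≢0 (inJ , minPoly) → inIdeal-·A {g = g} α inJ , minPoly-·A α α≢0 minPoly)
                              C-nonzero nc C-periodic C-period-∣
  open Counted cycles classes
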